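{- Let $\mathfrak{R}$ be either a finite field $\mathbb{F}_q$ or the ring $\mathbb{Z}_k$ ($k\ge 2$), let $C$ and $D$ be $\mathfrak{R}$-linear codes of length $n$, and let $\bm{w}\in\mathfrak{R}^n$. Then (i) \[ \mathfrak{Jac}(C^{\perp},D,\bm{w}; x_{a} : a \in \mathfrak{R}^{3}) =\frac{1}{|C|}\, \mathfrak{Jac}\Big(C,D,\bm{w};\ \sum_{b\in\mathfrak{R}}\chi(a_1 b)\, x_{(b, a_2, a_3)} \ :\ a=(a_1,a_2,a_3)\in\mathfrak{R}^{3}\Big), \] and (ii) \[ \mathfrak{Jac}(C^{\perp},D^{\perp},\bm{w}; x_{a} : a \in \mathfrak{R}^{3}) =\frac{1}{|C||D|}\, \mathfrak{Jac}\Big(C,D,\bm{w};\ \sum_{b_1,b_2\in\mathfrak{R}}\chi(a_1 b_1+a_2b_2)\, x_{(b_1, b_2, a_3)} \ :\ a=(a_1,a_2,a_3)\in\mathfrak{R}^{3}\Big), \] where on the right-hand sides each variable $x_a$ is replaced by the indicated expression.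
   Context: $\mathfrak{R}$ denotes either the finite field $\mathbb{F}_q$ ($q=p^f$, $p$ prime) or the ring $\mathbb{Z}_k$ of integers modulo $k\ge 2$. An $\mathfrak{R}$-linear code of length $n$ is an $\mathbb{F}_q$-subspace of $\mathbb{F}_q^n$ (if $\mathfrak{R}=\mathbb{F}_q$) or an additive subgroup of $\mathbb{Z}_k^n$ (if $\mathfrak{R}=\mathbb{Z}_k$). For $\bm{u},\bm{v}\in\mathfrak{R}^n$, $\bm{u}\cdot\bm{v}=\sum_i u_iv_i$, and the dual code of $C$ is $C^\perp=\{\bm{v}\in\mathfrak{R}^n : \bm{u}\cdot\bm{v}=0 \text{ for all } \bm{u}\in C\}$. The character $\chi:\mathfrak{R}\to\mathbb{C}^\times$ is fixed as follows: if $\mathfrak{R}=\mathbb{F}_q$, fix a primitive irreducible polynomial $F(x)$ of degree $f$ over $\mathbb{F}_p$ with root $\lambda$, write each $\alpha\in\mathbb{F}_q$ uniquely as $\alpha=\alpha_0+\alpha_1\lambda+\cdots+\alpha_{f-1}\lambda^{f-1}$ with $\alpha_i\in\mathbb{F}_p$, and set $\chi(\alpha)=\zeta_p^{\alpha_0}$ with $\zeta_p$ a primitive $p$-th root of unity; if $\mathfrak{R}=\mathbb{Z}_k$, set $\chi(\alpha)=\zeta_k^{\alpha}$ with $\zeta_k$ a primitive $k$-th root of unity. For $\bm{u},\bm{v},\bm{w}\in\mathfrak{R}^n$ and $a\in\mathfrak{R}^3$, let $h_a(\bm{u},\bm{v};\bm{w})=\#\{i : (u_i,v_i,w_i)=a\}$.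 The complete joint Jacobi polynomial of codes $C,D$ with respect to $\bm{w}$ is the polynomial in the variables $x_a$ ($a\in\mathfrak{R}^3$) \[\mathfrak{Jac}(C,D,\bm{w}; x_a : a\in\mathfrak{R}^3)=\sum_{\bm{u}\in C,\ \bm{v}\in D}\ \prod_{a\in\mathfrak{R}^3} x_a^{h_a(\bm{u},\bm{v};\bm{w})}.\] -}

module Defs where

open import Level using (Level; _⊔_)
open import Data.Nat as ℕ using (ℕ; zero; suc; NonZero; _≤_; _<_; _∸_; _^_)
open import Data.Nat.DivMod using (_%_; m%n<n)
open import Data.Nat.Primality using (Prime)
import Data.Nat.ListAction as ListAction
import Data.Bool.ListAction as BoolLA
open import Data.Fin as Fin using (Fin; toℕ; fromℕ<)
import Data.Fin.Properties as FinP
open import Data.Vec as Vec using (Vec; []; _∷_)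
import Data.Vec.Properties as VecP
open import Data.List as List using (List; []; _∷_)
open import Data.Bool using (Bool; true; false; not; _∨_; if_then_else_)
open import Data.Product using (_×_; _,_; ∃; Σ-syntax)
import Data.Product.Properties as ProdP
open import Relation.Binary.PropositionalEquality using (_≡_; _≢_)
open import Relation.Binary.Definitions using (DecidableEquality)
open import Relation.Nullary using (¬_; does)
open import Algebra.Bundles using (CommutativeRing)

module Mod (N : ℕ) .{{_ : NonZero N}} where
  reduce : ℕ → Fin N
  reduce m = fromℕ< (m%n<n m N)

  _+ₘ_ : Fin N → Fin N → Fin N
  a +ₘ b = reduce (toℕ a ℕ.+ toℕ b)

  _*ₘ_ : Fin N → Fin N → Fin N
  a *ₘ b = reduce (toℕ a ℕ.* toℕ b)

  -ₘ_ : Fin N → Fin N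
  -ₘ a = reduce (N ∸ toℕ a)

  0ₘ : Fin N
  0ₘ = reduce 0

  1ₘ : Fin N
  1ₘ = reduce 1

allVecs : ∀ {A : Set} → List A → (m : ℕ) → List (Vec A m)
allVecs xs zero    = [] ∷ []
allVecs xs (suc m) = List.concatMap (λ a → List.map (a ∷_) (allVecs xs m)) xs

-- The finite field F_q, q = p^f, f = suc m, realised as F_p[λ]/(F(λ)).
-- An element α = α_0 + α_1 λ + … + α_{f-1} λ^{f-1} is stored as the
-- coefficient vector (α_0 , … , α_{f-1}).  The monic polynomial
--   F(x) = x^f + F_{f-1} x^{f-1} + … + F_1 x + F_0
-- is given by its lower coefficients (F_0 , … , F_{f-1}).

module FieldRep (p m : ℕ) .{{_ : NonZero p}} (F : Vec (Fin p) (suc m)) where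
  open Mod p

  El : Set
  El = Vec (Fin p) (suc m)

  zeroF : El
  zeroF = Vec.replicate _ 0ₘ

  oneF : El
  oneF = 1ₘ ∷ Vec.replicate _ 0ₘ

  addF : El → El → El
  addF = Vec.zipWith _+ₘ_

  negF : El → El
  negF = Vec.map -ₘ_

  scaleF : Fin p → El → El
  scaleF c = Vec.map (c *ₘ_)

  -- multiplication by λ, using λ^f = -(F_0 + F_1 λ + … + F_{f-1} λ^{f-1})
  mulλ : El → El
  mulλ v = addF (0ₘ ∷ Vec.init v) (negF (scaleF (Vec.last v) F))

  -- (a_0 + a_1 λ + …) · b  =  a_0 b + λ (a_1 b + λ (…))   (Horner)
  mulF : El → El → El
  mulF a b = Vec.foldr (λ _ → El) (λ aᵢ acc → addF (scaleF aᵢ b) (mulλ acc)) zeroF a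

  λF : El
  λF = mulλ oneF

  powF : El → ℕ → El
  powF x zero    = oneF
  powF x (suc j) = mulF x (powF x j)

  -- Polynomials over F_p as coefficient lists (constant term first).
  coeff : List (Fin p) → ℕ → Fin p
  coeff []       _       = 0ₘ
  coeff (c ∷ cs) zero    = c
  coeff (c ∷ cs) (suc i) = coeff cs i

  mulCoeff : List (Fin p) → List (Fin p) → ℕ → Fin p
  mulCoeff g h i = reduce (ListAction.sum (List.map (λ j → toℕ (coeff g j) ℕ.* toℕ (coeff h (i ∸ j))) (List.upTo (suc i))))

  Fpoly : List (Fin p)
  Fpoly = Vec.toList F List.++ (1ₘ ∷ [])

  PositiveDegree : List (Fin p) → Set
  PositiveDegree g = ∃ λ i → 1 ≤ i × coeff g i ≢ 0ₘ

  IrreducibleF : Set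
  IrreducibleF = ∀ (g h : List (Fin p)) → PositiveDegree g → PositiveDegree h →
                 ¬ (∀ i → mulCoeff g h i ≡ coeff Fpoly i)

  PrimitiveF : Set
  PrimitiveF = powF λF (p ^ suc m ∸ 1) ≡ oneF ×
               (∀ j → 1 ≤ j → j < p ^ suc m ∸ 1 → powF λF j ≢ oneF)

data Spec : Set where
  Fq : (p m : ℕ) .{{_ : NonZero p}} → Prime p → (F : Vec (Fin p) (suc m)) →
       FieldRep.IrreducibleF p m F → FieldRep.PrimitiveF p m F → Spec
  Zk : (k : ℕ) .{{_ : NonZero k}} → 2 ≤ k → Spec

El : Spec → Set
El (Fq p m {{_}} _ F _ _) = FieldRep.El p m F
El (Zk k {{_}} _)         = Fin k

_≟ᴿ_ : (σ : Spec) → DecidableEquality (El σ)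
_≟ᴿ_ (Fq p m {{_}} _ F _ _) = VecP.≡-dec FinP._≟_
_≟ᴿ_ (Zk k {{_}} _)         = FinP._≟_

elems : (σ : Spec) → List (El σ)
elems (Fq p m {{_}} _ F _ _) = allVecs (List.allFin p) (suc m)
elems (Zk k {{_}} _)         = List.allFin k

zeroR : (σ : Spec) → El σ
zeroR (Fq p m {{_}} _ F _ _) = FieldRep.zeroF p m F
zeroR (Zk k {{_}} _)         = Mod.0ₘ k

addR : (σ : Spec) → El σ → El σ → El σ
addR (Fq p m {{_}} _ F _ _) = FieldRep.addF p m F
addR (Zk k {{_}} _)         = Mod._+ₘ_ k

mulR : (σ : Spec) → El σ → El σ → El σ
mulR (Fq p m {{_}} _ F _ _) = FieldRep.mulF p m F
mulR (Zk k {{_}} _)         = Mod._*ₘ_ k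

negR : (σ : Spec) → El σ → El σ
negR (Fq p m {{_}} _ F _ _) = FieldRep.negF p m F
negR (Zk k {{_}} _)         = Mod.-ₘ_ k

-- order of the root of unity ζ used by χ  (p for F_q, k for Z_k)
ord : Spec → ℕ
ord (Fq p _ _ _ _ _) = p
ord (Zk k {{_}} _)         = k

-- χ(α) = ζ ^ (chiExp α):  chiExp α = α_0 for F_q, chiExp α = α for Z_k
chiExp : (σ : Spec) → El σ → ℕ
chiExp (Fq p m {{_}} _ F _ _) α = toℕ (Vec.head α)
chiExp (Zk k {{_}} _)         α = toℕ α

Word : Spec → ℕ → Set
Word σ n = Vec (El σ) n

allWords : (σ : Spec) (n : ℕ) → List (Word σ n)
allWords σ n = allVecs (elems σ) n

-- a code of length n, given by its (decidable) membership predicate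
Code : Spec → ℕ → Set
Code σ n = Word σ n → Bool

dot : (σ : Spec) {n : ℕ} → Word σ n → Word σ n → El σ
dot σ u v = Vec.foldr (λ _ → El σ) (addR σ) (zeroR σ) (Vec.zipWith (mulR σ) u v)

isZero : (σ : Spec) → El σ → Bool
isZero σ a = does (_≟ᴿ_ σ a (zeroR σ))

dual : (σ : Spec) {n : ℕ} → Code σ n → Code σ n
dual σ {n} C v = BoolLA.and (List.map (λ u → not (C u) ∨ isZero σ (dot σ u v)) (allWords σ n))

size : (σ : Spec) {n : ℕ} → Code σ n → ℕ
size σ {n} C = List.length (List.filterᵇ C (allWords σ n))

-- 𝔑-linear codes: F_q-subspaces, resp. additive subgroups of Z_k^n
IsLinear : (σ : Spec) {n : ℕ} → Code σ n → Set
IsLinear σ@(Fq _ _ _ _ _ _) {n} C =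
  (C (Vec.replicate n (zeroR σ)) ≡ true) ×
  (∀ u v → C u ≡ true → C v ≡ true → C (Vec.zipWith (addR σ) u v) ≡ true) ×
  (∀ c u → C u ≡ true → C (Vec.map (mulR σ c) u) ≡ true)
IsLinear σ@(Zk _ _) {n} C =
  (C (Vec.replicate n (zeroR σ)) ≡ true) ×
  (∀ u v → C u ≡ true → C v ≡ true → C (Vec.zipWith (addR σ) u v) ≡ true) ×
  (∀ u → C u ≡ true → C (Vec.map (negR σ) u) ≡ true)

Triple : Spec → Set
Triple σ = El σ × El σ × El σ

_≟³_ : (σ : Spec) → DecidableEquality (Triple σ)
_≟³_ σ = ProdP.≡-dec (_≟ᴿ_ σ) (ProdP.≡-dec (_≟ᴿ_ σ) (_≟ᴿ_ σ))

allTriples : (σ : Spec) → List (Triple σ)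
allTriples σ = List.concatMap (λ a → List.concatMap (λ b → List.map (λ c → (a , b , c)) (elems σ)) (elems σ)) (elems σ)

h : (σ : Spec) {n : ℕ} → Triple σ → Word σ n → Word σ n → Word σ n → ℕ
h σ a u v w = List.length (List.filterᵇ (λ t → does (_≟³_ σ t a))
                 (Vec.toList (Vec.zipWith _,_ u (Vec.zipWith _,_ v w))))

-- Polynomial expressions evaluated in a commutative ring S
-- (the x_a are given values x a ∈ S; ζ ∈ S plays the root of unity)

module InRing {c ℓ : Level} (S : CommutativeRing c ℓ) where
  open CommutativeRing S

  pow : Carrier → ℕ → Carrier
  pow x zero    = 1#
  pow x (suc j) = x * pow x j

  _·ₙ_ : ℕ → Carrier → Carrier
  zero  ·ₙ s = 0#
  suc n ·ₙ s = s + (n ·ₙ s)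

  Σ : {A : Set} → List A → (A → Carrier) → Carrier
  Σ xs g = List.foldr (λ a acc → g a + acc) 0# xs

  Π : {A : Set} → List A → (A → Carrier) → Carrier
  Π xs g = List.foldr (λ a acc → g a * acc) 1# xs

  NonZeroDivisor : Carrier → Set (c ⊔ ℓ)
  NonZeroDivisor s = ∀ t → s * t ≈ 0# → t ≈ 0#

  module _ (σ : Spec) (ζ : Carrier) where
    χ : El σ → Carrier
    χ α = pow ζ (chiExp σ α)

    Jac : {n : ℕ} → Code σ n → Code σ n → Word σ n → (Triple σ → Carrier) → Carrier
    Jac {n} C D w x =
      Σ (List.filterᵇ C (allWords σ n)) λ u →
      Σ (List.filterᵇ D (allWords σ n)) λ v →
      Π (allTriples σ) λ a → pow (x a) (h σ a u v w)

    subst₁ : (Triple σ → Carrier) → Triple σ → Carrier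
    subst₁ x (a₁ , a₂ , a₃) = Σ (elems σ) λ b → χ (mulR σ a₁ b) * x (b , a₂ , a₃)

    subst₂ : (Triple σ → Carrier) → Triple σ → Carrier
    subst₂ x (a₁ , a₂ , a₃) =
      Σ (elems σ) λ b₁ → Σ (elems σ) λ b₂ →
        χ (addR σ (mulR σ a₁ b₁) (mulR σ a₂ b₂)) * x (b₁ , b₂ , a₃)

module Submission where

-- For an 𝔑-linear code C, the character sum Σ_{u ∈ C} χ(u·b) is |C| when b ∈ C^⊥ and 0 otherwise:
-- if u₀·b ≠ 0 for some u₀ ∈ C, some u′ ∈ C has χ(u′·b) = ζ^j with 0 < j < ord, translation by u′
-- permutes C, so (1 - ζ^j) annihilates the sum, and 1 - ζ^j is not a zero divisor. Multiplying
-- Jac(C^⊥, D) by |C| therefore trades the restriction to C^⊥ for this character sum; exchanging the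
-- order of summation and expanding the product over coordinates gives Jac(C, D) at the substituted
-- variables. Doing this for both codes gives (ii).
-- For 𝔽_q = 𝔽_p[λ]/(F) the existence of u′ is the nondegeneracy of (c, t) ↦ (c·t)₀: multiplication
-- by λ shifts the coefficients of t up and moves its top coefficient a to the constant term as -a·F(0),
-- where F(0) ≠ 0 because λ is a unit; so some λ^j·t has a nonzero constant term when t ≠ 0.

open import Data.Nat using (ℕ; NonZero; suc)
open import Data.Nat.Primality using (Prime)
open import Defs using (module FieldRep)
open import Data.Fin using (Fin)
open import Data.Vec using (Vec)
open import Algebra.Core using (Op₁; Op₂)
open import Algebra.Structures using (IsCommutativeRing)
open import Relation.Binary.PropositionalEquality using (_≡_)

module ModularArithmetic (N : ℕ) .{{_ : NonZero N}} where

  open import Level using (0ℓ)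
  open import Data.Nat using (_+_; _*_; _∸_; >-nonZero⁻¹)
  import Data.Nat.Properties as ℕP
  open import Data.Nat.DivMod using (_%_; m%n<n; m<n⇒m%n≡m; m%n%n≡m%n; %-distribˡ-+; %-distribˡ-*; n%n≡0)
  open import Data.Fin using (toℕ)
  import Data.Fin.Properties as FinP
  open import Data.Product using (_,_)
  open import Algebra.Bundles using (CommutativeRing)
  open import Relation.Binary.PropositionalEquality
  open import Defs using (module Mod)
  open Mod N
  open ≡-Reasoning

  toℕ-reduce : ∀ m → toℕ (reduce m) ≡ m % N
  toℕ-reduce m = FinP.toℕ-fromℕ< (m%n<n m N)

  reduce-cong : ∀ {m n} → m % N ≡ n % N → reduce m ≡ reduce n
  reduce-cong {m} {n} e = FinP.fromℕ<-cong _ _ e (m%n<n m N) (m%n<n n N)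

  reduce-toℕ : ∀ a → reduce (toℕ a) ≡ a
  reduce-toℕ a = FinP.toℕ-injective (trans (toℕ-reduce (toℕ a)) (m<n⇒m%n≡m (FinP.toℕ<n a)))

  toℕ-0ₘ : toℕ 0ₘ ≡ 0
  toℕ-0ₘ = trans (toℕ-reduce 0) (m<n⇒m%n≡m (>-nonZero⁻¹ N))

  reduce-+ˡ : ∀ m n → reduce (toℕ (reduce m) + n) ≡ reduce (m + n)
  reduce-+ˡ m n = reduce-cong (begin
    (toℕ (reduce m) + n) % N          ≡⟨ cong (λ k → (k + n) % N) (toℕ-reduce m) ⟩
    (m % N + n) % N                   ≡⟨ %-distribˡ-+ (m % N) n N ⟩
    (m % N % N + n % N) % N           ≡⟨ cong (λ k → (k + n % N) % N) (m%n%n≡m%n m N) ⟩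
    (m % N + n % N) % N               ≡⟨ %-distribˡ-+ m n N ⟨
    (m + n) % N                       ∎)

  reduce-+ʳ : ∀ m n → reduce (m + toℕ (reduce n)) ≡ reduce (m + n)
  reduce-+ʳ m n = begin
    reduce (m + toℕ (reduce n))       ≡⟨ cong reduce (ℕP.+-comm m _) ⟩
    reduce (toℕ (reduce n) + m)       ≡⟨ reduce-+ˡ n m ⟩
    reduce (n + m)                    ≡⟨ cong reduce (ℕP.+-comm n m) ⟩
    reduce (m + n)                    ∎

  reduce-*ˡ : ∀ m n → reduce (toℕ (reduce m) * n) ≡ reduce (m * n)
  reduce-*ˡ m n = reduce-cong (begin
    (toℕ (reduce m) * n) % N          ≡⟨ cong (λ k → (k * n) % N) (toℕ-reduce m) ⟩
    (m % N * n) % N                   ≡⟨ %-distribˡ-* (m % N) n N ⟩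
    (m % N % N * (n % N)) % N         ≡⟨ cong (λ k → (k * (n % N)) % N) (m%n%n≡m%n m N) ⟩
    (m % N * (n % N)) % N             ≡⟨ %-distribˡ-* m n N ⟨
    (m * n) % N                       ∎)

  reduce-*ʳ : ∀ m n → reduce (m * toℕ (reduce n)) ≡ reduce (m * n)
  reduce-*ʳ m n = begin
    reduce (m * toℕ (reduce n))       ≡⟨ cong reduce (ℕP.*-comm m _) ⟩
    reduce (toℕ (reduce n) * m)       ≡⟨ reduce-*ˡ n m ⟩
    reduce (n * m)                    ≡⟨ cong reduce (ℕP.*-comm n m) ⟩
    reduce (m * n)                    ∎

  +ₘ-comm : ∀ a b → a +ₘ b ≡ b +ₘ a
  +ₘ-comm a b = cong reduce (ℕP.+-comm (toℕ a) (toℕ b))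

  +ₘ-assoc : ∀ a b c → (a +ₘ b) +ₘ c ≡ a +ₘ (b +ₘ c)
  +ₘ-assoc a b c = begin
    reduce (toℕ (reduce (toℕ a + toℕ b)) + toℕ c)   ≡⟨ reduce-+ˡ (toℕ a + toℕ b) (toℕ c) ⟩
    reduce (toℕ a + toℕ b + toℕ c)                   ≡⟨ cong reduce (ℕP.+-assoc (toℕ a) _ _) ⟩
    reduce (toℕ a + (toℕ b + toℕ c))                 ≡⟨ reduce-+ʳ (toℕ a) (toℕ b + toℕ c) ⟨
    reduce (toℕ a + toℕ (reduce (toℕ b + toℕ c)))   ∎

  +ₘ-identityˡ : ∀ a → 0ₘ +ₘ a ≡ a
  +ₘ-identityˡ a = trans (cong (λ k → reduce (k + toℕ a)) toℕ-0ₘ) (reduce-toℕ a)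

  +ₘ-identityʳ : ∀ a → a +ₘ 0ₘ ≡ a
  +ₘ-identityʳ a = trans (+ₘ-comm a 0ₘ) (+ₘ-identityˡ a)

  -ₘ-inverseʳ : ∀ a → a +ₘ (-ₘ a) ≡ 0ₘ
  -ₘ-inverseʳ a = begin
    reduce (toℕ a + toℕ (reduce (N ∸ toℕ a)))   ≡⟨ reduce-+ʳ (toℕ a) (N ∸ toℕ a) ⟩
    reduce (toℕ a + (N ∸ toℕ a))                 ≡⟨ cong reduce (ℕP.m+[n∸m]≡n (ℕP.<⇒≤ (FinP.toℕ<n a))) ⟩
    reduce N                                     ≡⟨ reduce-cong (trans (n%n≡0 N) (sym (m<n⇒m%n≡m (>-nonZero⁻¹ N)))) ⟩
    reduce 0                                     ∎

  -ₘ-inverseˡ : ∀ a → (-ₘ a) +ₘ a ≡ 0ₘ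
  -ₘ-inverseˡ a = trans (+ₘ-comm _ a) (-ₘ-inverseʳ a)

  *ₘ-comm : ∀ a b → a *ₘ b ≡ b *ₘ a
  *ₘ-comm a b = cong reduce (ℕP.*-comm (toℕ a) (toℕ b))

  *ₘ-assoc : ∀ a b c → (a *ₘ b) *ₘ c ≡ a *ₘ (b *ₘ c)
  *ₘ-assoc a b c = begin
    reduce (toℕ (reduce (toℕ a * toℕ b)) * toℕ c)   ≡⟨ reduce-*ˡ (toℕ a * toℕ b) (toℕ c) ⟩
    reduce (toℕ a * toℕ b * toℕ c)                   ≡⟨ cong reduce (ℕP.*-assoc (toℕ a) _ _) ⟩
    reduce (toℕ a * (toℕ b * toℕ c))                 ≡⟨ reduce-*ʳ (toℕ a) (toℕ b * toℕ c) ⟨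
    reduce (toℕ a * toℕ (reduce (toℕ b * toℕ c)))   ∎

  *ₘ-identityˡ : ∀ a → 1ₘ *ₘ a ≡ a
  *ₘ-identityˡ a = begin
    reduce (toℕ (reduce 1) * toℕ a)   ≡⟨ reduce-*ˡ 1 (toℕ a) ⟩
    reduce (1 * toℕ a)                ≡⟨ cong reduce (ℕP.*-identityˡ (toℕ a)) ⟩
    reduce (toℕ a)                    ≡⟨ reduce-toℕ a ⟩
    a                                 ∎

  *ₘ-identityʳ : ∀ a → a *ₘ 1ₘ ≡ a
  *ₘ-identityʳ a = trans (*ₘ-comm a 1ₘ) (*ₘ-identityˡ a)

  *ₘ-distribʳ : ∀ c a b → (a +ₘ b) *ₘ c ≡ (a *ₘ c) +ₘ (b *ₘ c)
  *ₘ-distribʳ c a b = begin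
    reduce (toℕ (reduce (toℕ a + toℕ b)) * toℕ c)   ≡⟨ reduce-*ˡ (toℕ a + toℕ b) (toℕ c) ⟩
    reduce ((toℕ a + toℕ b) * toℕ c)                 ≡⟨ cong reduce (ℕP.*-distribʳ-+ (toℕ c) (toℕ a) _) ⟩
    reduce (toℕ a * toℕ c + toℕ b * toℕ c)           ≡⟨ reduce-+ˡ (toℕ a * toℕ c) _ ⟨
    reduce (toℕ (a *ₘ c) + toℕ b * toℕ c)            ≡⟨ reduce-+ʳ (toℕ (a *ₘ c)) _ ⟨
    reduce (toℕ (a *ₘ c) + toℕ (b *ₘ c))             ∎

  *ₘ-distribˡ : ∀ c a b → c *ₘ (a +ₘ b) ≡ (c *ₘ a) +ₘ (c *ₘ b)
  *ₘ-distribˡ c a b = begin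
    c *ₘ (a +ₘ b)            ≡⟨ *ₘ-comm c _ ⟩
    (a +ₘ b) *ₘ c            ≡⟨ *ₘ-distribʳ c a b ⟩
    (a *ₘ c) +ₘ (b *ₘ c)     ≡⟨ cong₂ _+ₘ_ (*ₘ-comm a c) (*ₘ-comm b c) ⟩
    (c *ₘ a) +ₘ (c *ₘ b)     ∎

  commutativeRing : CommutativeRing 0ℓ 0ℓ
  commutativeRing = record
    { Carrier = Fin N ; _≈_ = _≡_ ; _+_ = _+ₘ_ ; _*_ = _*ₘ_ ; -_ = -ₘ_ ; 0# = 0ₘ ; 1# = 1ₘ
    ; isCommutativeRing = record
      { isRing = record
        { +-isAbelianGroup = record
          { isGroup = record
            { isMonoid = record
              { isSemigroup = record { isMagma = isMagma _+ₘ_ ; assoc = +ₘ-assoc }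
              ; identity = +ₘ-identityˡ , +ₘ-identityʳ
              }
            ; inverse = -ₘ-inverseˡ , -ₘ-inverseʳ
            ; ⁻¹-cong = cong -ₘ_
            }
          ; comm = +ₘ-comm
          }
        ; *-cong = cong₂ _*ₘ_
        ; *-assoc = *ₘ-assoc
        ; *-identity = *ₘ-identityˡ , *ₘ-identityʳ
        ; distrib = *ₘ-distribˡ , *ₘ-distribʳ
        }
      ; *-comm = *ₘ-comm
      }
    }

module VecLemmas where

  open import Data.Nat using (ℕ; zero; suc)
  open import Data.Fin as Fin using (Fin)
  open import Data.Product using (_,_; proj₂)
  open import Data.Vec as Vec using (Vec; []; _∷_; _∷ʳ_; zipWith; replicate; head; init; last; lookup)
  import Data.Vec.Properties as VecP
  open import Algebra.Structures using (IsAbelianGroup)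
  open import Relation.Binary.PropositionalEquality

  private variable
    A B C : Set
    k : ℕ

  init-zipWith : ∀ (f : A → B → C) (a : Vec A (suc k)) b → init (zipWith f a b) ≡ zipWith f (init a) (init b)
  init-zipWith {k = zero}  f (x ∷ []) (y ∷ []) = refl
  init-zipWith {k = suc k} f (x ∷ a)  (y ∷ b)  = cong (f x y ∷_) (init-zipWith f a b)

  last-zipWith : ∀ (f : A → B → C) (a : Vec A (suc k)) b → last (zipWith f a b) ≡ f (last a) (last b)
  last-zipWith {k = zero}  f (x ∷ []) (y ∷ []) = refl
  last-zipWith {k = suc k} f (x ∷ a)  (y ∷ b)  = last-zipWith f a b

  init-map : ∀ (f : A → B) (a : Vec A (suc k)) → init (Vec.map f a) ≡ Vec.map f (init a)
  init-map {k = zero}  f (x ∷ []) = refl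
  init-map {k = suc k} f (x ∷ a)  = cong (f x ∷_) (init-map f a)

  last-map : ∀ (f : A → B) (a : Vec A (suc k)) → last (Vec.map f a) ≡ f (last a)
  last-map {k = zero}  f (x ∷ []) = refl
  last-map {k = suc k} f (x ∷ a)  = last-map f a

  init-replicate : ∀ k (x : A) → init (replicate (suc k) x) ≡ replicate k x
  init-replicate zero    x = refl
  init-replicate (suc k) x = cong (x ∷_) (init-replicate k x)

  last-replicate : ∀ k (x : A) → last (replicate (suc k) x) ≡ x
  last-replicate zero    x = refl
  last-replicate (suc k) x = last-replicate k x

  head-zipWith : ∀ (f : A → B → C) (a : Vec A (suc k)) b → head (zipWith f a b) ≡ f (head a) (head b)
  head-zipWith f (x ∷ a) (y ∷ b) = refl

  head-map : ∀ (f : A → B) (a : Vec A (suc k)) → head (Vec.map f a) ≡ f (head a)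
  head-map f (x ∷ a) = refl

  lookup-init : ∀ (v : Vec A (suc k)) (i : Fin k) → lookup (init v) i ≡ lookup v (Fin.inject₁ i)
  lookup-init {k = suc k} (x ∷ v) Fin.zero    = refl
  lookup-init {k = suc k} (x ∷ v) (Fin.suc i) = lookup-init v i

  last-lookup : ∀ (v : Vec A (suc k)) → last v ≡ lookup v (Fin.fromℕ k)
  last-lookup {k = zero}  (x ∷ []) = refl
  last-lookup {k = suc k} (x ∷ v)  = last-lookup v

  init-last-injective : ∀ (u v : Vec A (suc k)) → init u ≡ init v → last u ≡ last v → u ≡ v
  init-last-injective u v init≡ last≡ = begin
    u               ≡⟨ proj₂ (proj₂ (Vec.initLast u)) ⟩
    init u ∷ʳ last u ≡⟨ cong₂ _∷ʳ_ init≡ last≡ ⟩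
    init v ∷ʳ last v ≡⟨ proj₂ (proj₂ (Vec.initLast v)) ⟨
    v               ∎
    where open ≡-Reasoning

  lookup-extensionality : ∀ (u v : Vec A k) → (∀ i → lookup u i ≡ lookup v i) → u ≡ v
  lookup-extensionality u v e =
    trans (sym (VecP.tabulate∘lookup u)) (trans (VecP.tabulate-cong e) (VecP.tabulate∘lookup v))

  zipWith-isAbelianGroup : ∀ {_∙_ : Op₂ A} {ε : A} {_⁻¹ : Op₁ A} → IsAbelianGroup _≡_ _∙_ ε _⁻¹ →
                           IsAbelianGroup _≡_ (zipWith {n = k} _∙_) (replicate k ε) (Vec.map _⁻¹)
  zipWith-isAbelianGroup G = record
    { isGroup = record
      { isMonoid = record
        { isSemigroup = record { isMagma = isMagma _ ; assoc = VecP.zipWith-assoc assoc }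
        ; identity = VecP.zipWith-identityˡ identityˡ , VecP.zipWith-identityʳ identityʳ
        }
      ; inverse = VecP.zipWith-inverseˡ inverseˡ , VecP.zipWith-inverseʳ inverseʳ
      ; ⁻¹-cong = cong (Vec.map _)
      }
    ; comm = VecP.zipWith-comm comm
    }
    where open IsAbelianGroup G using (assoc; identityˡ; identityʳ; inverseˡ; inverseʳ; comm)

module Coordinatewise {A : Set} {_+_ _*_ : Op₂ A} { -_ : Op₁ A} {0# 1# : A}
                      (isCommutativeRing : IsCommutativeRing _≡_ _+_ _*_ -_ 0# 1#) where

  open import Level using (0ℓ)
  open import Data.Nat using (ℕ; zero; suc)
  open import Data.Vec as Vec using (Vec; []; _∷_; zipWith; replicate)
  open import Algebra.Bundles using (AbelianGroup; CommutativeRing)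
  import Algebra.Properties.AbelianGroup as AbelianGroupProperties
  import Algebra.Properties.CommutativeSemigroup as CommutativeSemigroupProperties
  import Algebra.Properties.Ring as RingProperties
  open import Relation.Binary.PropositionalEquality
  open VecLemmas using (zipWith-isAbelianGroup)

  private
    R : CommutativeRing 0ℓ 0ℓ
    R = record { isCommutativeRing = isCommutativeRing }
    open CommutativeRing R using (+-isAbelianGroup; *-assoc; distribˡ; distribʳ; zeroˡ; zeroʳ; *-identityˡ; ring)
    variable k : ℕ

  infixl 6 _⊕_
  infixr 7 _·_

  _⊕_ : Vec A k → Vec A k → Vec A k
  _⊕_ = zipWith _+_

  𝟘 : Vec A k
  𝟘 = replicate _ 0#

  ⊖_ : Vec A k → Vec A k
  ⊖_ = Vec.map -_

  _·_ : A → Vec A k → Vec A k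
  c · v = Vec.map (c *_) v

  ⊕-abelianGroup : ℕ → AbelianGroup 0ℓ 0ℓ
  ⊕-abelianGroup k = record { isAbelianGroup = zipWith-isAbelianGroup {k = k} +-isAbelianGroup }

  module _ {k : ℕ} where
    open AbelianGroup (⊕-abelianGroup k) public
      using () renaming (identityˡ to ⊕-identityˡ; identityʳ to ⊕-identityʳ)
    open AbelianGroupProperties (⊕-abelianGroup k) public
      using () renaming (⁻¹-∙-comm to ⊖-⊕-comm; ε⁻¹≈ε to ⊖-𝟘)
    open CommutativeSemigroupProperties (AbelianGroup.commutativeSemigroup (⊕-abelianGroup k)) public
      using () renaming (interchange to ⊕-interchange)

  ·-distrib-⊕ : ∀ c (a b : Vec A k) → c · (a ⊕ b) ≡ c · a ⊕ c · b
  ·-distrib-⊕ c []      []      = refl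
  ·-distrib-⊕ c (x ∷ a) (y ∷ b) = cong₂ _∷_ (distribˡ c x y) (·-distrib-⊕ c a b)

  +-distrib-· : ∀ c d (a : Vec A k) → (c + d) · a ≡ c · a ⊕ d · a
  +-distrib-· c d []      = refl
  +-distrib-· c d (x ∷ a) = cong₂ _∷_ (distribʳ x c d) (+-distrib-· c d a)

  ·-assoc : ∀ c d (a : Vec A k) → c · d · a ≡ (c * d) · a
  ·-assoc c d []      = refl
  ·-assoc c d (x ∷ a) = cong₂ _∷_ (sym (*-assoc c d x)) (·-assoc c d a)

  ·-zeroˡ : ∀ (a : Vec A k) → 0# · a ≡ 𝟘
  ·-zeroˡ []      = refl
  ·-zeroˡ (x ∷ a) = cong₂ _∷_ (zeroˡ x) (·-zeroˡ a)

  ·-zeroʳ : ∀ k c → c · 𝟘 {k} ≡ 𝟘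
  ·-zeroʳ zero    c = refl
  ·-zeroʳ (suc k) c = cong₂ _∷_ (zeroʳ c) (·-zeroʳ k c)

  ·-identityˡ : ∀ (a : Vec A k) → 1# · a ≡ a
  ·-identityˡ []      = refl
  ·-identityˡ (x ∷ a) = cong₂ _∷_ (*-identityˡ x) (·-identityˡ a)

  ⊖-· : ∀ c (a : Vec A k) → ⊖ (c · a) ≡ c · ⊖ a
  ⊖-· c []      = refl
  ⊖-· c (x ∷ a) = cong₂ _∷_ (RingProperties.-‿distribʳ-* ring c x) (⊖-· c a)

module PolynomialQuotient (p m : ℕ) .{{_ : NonZero p}} (F : Vec (Fin p) (suc m)) where

  open import Level using (0ℓ)
  open import Data.Nat using (zero; suc; _≤_; s≤s)
  import Data.Nat.Properties as ℕP
  open import Data.Fin as Fin using (toℕ)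
  import Data.Fin.Properties as FinP
  open import Data.Vec using ([]; _∷_; foldr; init; last; lookup; toList)
  import Data.Vec.Properties as VecP
  open import Data.Product using (_,_)
  open import Algebra.Bundles using (CommutativeRing; AbelianGroup)
  open import Relation.Binary.PropositionalEquality
  open import Defs using (module Mod; module FieldRep)
  open Mod p
  open FieldRep p m F
  open VecLemmas
  private module ℤ/p = CommutativeRing (ModularArithmetic.commutativeRing p)
  open Coordinatewise ℤ/p.isCommutativeRing
  open ≡-Reasoning

  mulλ-⊕ : ∀ a b → mulλ (a ⊕ b) ≡ mulλ a ⊕ mulλ b
  mulλ-⊕ a b = begin
    (0ₘ ∷ init (a ⊕ b)) ⊕ ⊖ (last (a ⊕ b) · F)
      ≡⟨ cong₂ (λ u c → (0ₘ ∷ u) ⊕ ⊖ (c · F)) (init-zipWith _+ₘ_ a b) (last-zipWith _+ₘ_ a b) ⟩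
    (0ₘ ∷ init a ⊕ init b) ⊕ ⊖ ((last a +ₘ last b) · F)
      ≡⟨ cong₂ (λ c v → (c ∷ init a ⊕ init b) ⊕ ⊖ v) (sym (ℤ/p.+-identityˡ 0ₘ)) (+-distrib-· (last a) (last b) F) ⟩
    ((0ₘ ∷ init a) ⊕ (0ₘ ∷ init b)) ⊕ ⊖ (last a · F ⊕ last b · F)
      ≡⟨ cong (_ ⊕_) (⊖-⊕-comm _ _) ⟨
    ((0ₘ ∷ init a) ⊕ (0ₘ ∷ init b)) ⊕ (⊖ (last a · F) ⊕ ⊖ (last b · F))
      ≡⟨ ⊕-interchange _ _ _ _ ⟩
    mulλ a ⊕ mulλ b ∎

  mulλ-· : ∀ c a → mulλ (c · a) ≡ c · mulλ a
  mulλ-· c a = begin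
    (0ₘ ∷ init (c · a)) ⊕ ⊖ (last (c · a) · F)
      ≡⟨ cong₂ (λ u d → (0ₘ ∷ u) ⊕ ⊖ (d · F)) (init-map (c *ₘ_) a) (last-map (c *ₘ_) a) ⟩
    (0ₘ ∷ c · init a) ⊕ ⊖ ((c *ₘ last a) · F)
      ≡⟨ cong₂ (λ d v → (d ∷ c · init a) ⊕ ⊖ v) (sym (ℤ/p.zeroʳ c)) (sym (·-assoc c (last a) F)) ⟩
    c · (0ₘ ∷ init a) ⊕ ⊖ (c · last a · F)
      ≡⟨ cong (_ ⊕_) (⊖-· c _) ⟩
    c · (0ₘ ∷ init a) ⊕ c · ⊖ (last a · F)
      ≡⟨ ·-distrib-⊕ c _ _ ⟨
    c · mulλ a ∎

  mulλ-shift : ∀ v → last v ≡ 0ₘ → mulλ v ≡ 0ₘ ∷ init v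
  mulλ-shift v last≡0 = begin
    (0ₘ ∷ init v) ⊕ ⊖ (last v · F)   ≡⟨ cong (λ c → (0ₘ ∷ init v) ⊕ ⊖ (c · F)) last≡0 ⟩
    (0ₘ ∷ init v) ⊕ ⊖ (0ₘ · F)       ≡⟨ cong (λ u → (0ₘ ∷ init v) ⊕ ⊖ u) (·-zeroˡ F) ⟩
    (0ₘ ∷ init v) ⊕ ⊖ 𝟘              ≡⟨ cong ((0ₘ ∷ init v) ⊕_) ⊖-𝟘 ⟩
    (0ₘ ∷ init v) ⊕ 𝟘                ≡⟨ ⊕-identityʳ _ ⟩
    0ₘ ∷ init v                      ∎

  mulλ-𝟘 : mulλ 𝟘 ≡ 𝟘
  mulλ-𝟘 = trans (mulλ-shift 𝟘 (last-replicate m 0ₘ)) (cong (0ₘ ∷_) (init-replicate m 0ₘ))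

  horner : ∀ {k} → Vec (Fin p) k → El → El
  horner a b = foldr (λ _ → El) (λ aᵢ acc → addF (scaleF aᵢ b) (mulλ acc)) zeroF a

  horner-𝟘ˡ : ∀ k b → horner (𝟘 {k}) b ≡ 𝟘
  horner-𝟘ˡ zero    b = refl
  horner-𝟘ˡ (suc k) b = begin
    0ₘ · b ⊕ mulλ (horner (𝟘 {k}) b)   ≡⟨ cong₂ _⊕_ (·-zeroˡ b) (trans (cong mulλ (horner-𝟘ˡ k b)) mulλ-𝟘) ⟩
    𝟘 ⊕ 𝟘                              ≡⟨ ⊕-identityˡ 𝟘 ⟩
    𝟘                                  ∎

  horner-𝟘ʳ : ∀ {k} (a : Vec (Fin p) k) → horner a 𝟘 ≡ 𝟘
  horner-𝟘ʳ []      = refl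
  horner-𝟘ʳ (x ∷ a) = begin
    x · 𝟘 ⊕ mulλ (horner a 𝟘)   ≡⟨ cong₂ _⊕_ (·-zeroʳ (suc m) x) (trans (cong mulλ (horner-𝟘ʳ a)) mulλ-𝟘) ⟩
    𝟘 ⊕ 𝟘                       ≡⟨ ⊕-identityˡ 𝟘 ⟩
    𝟘                           ∎

  horner-⊕ˡ : ∀ {k} (a a′ : Vec (Fin p) k) b → horner (a ⊕ a′) b ≡ horner a b ⊕ horner a′ b
  horner-⊕ˡ []      []        b = sym (⊕-identityˡ 𝟘)
  horner-⊕ˡ (x ∷ a) (x′ ∷ a′) b = begin
    (x +ₘ x′) · b ⊕ mulλ (horner (a ⊕ a′) b)
      ≡⟨ cong₂ _⊕_ (+-distrib-· x x′ b) (trans (cong mulλ (horner-⊕ˡ a a′ b)) (mulλ-⊕ _ _)) ⟩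
    (x · b ⊕ x′ · b) ⊕ (mulλ (horner a b) ⊕ mulλ (horner a′ b))
      ≡⟨ ⊕-interchange _ _ _ _ ⟩
    horner (x ∷ a) b ⊕ horner (x′ ∷ a′) b ∎

  horner-⊕ʳ : ∀ {k} (a : Vec (Fin p) k) b b′ → horner a (b ⊕ b′) ≡ horner a b ⊕ horner a b′
  horner-⊕ʳ []      b b′ = sym (⊕-identityˡ 𝟘)
  horner-⊕ʳ (x ∷ a) b b′ = begin
    x · (b ⊕ b′) ⊕ mulλ (horner a (b ⊕ b′))
      ≡⟨ cong₂ _⊕_ (·-distrib-⊕ x b b′) (trans (cong mulλ (horner-⊕ʳ a b b′)) (mulλ-⊕ _ _)) ⟩
    (x · b ⊕ x · b′) ⊕ (mulλ (horner a b) ⊕ mulλ (horner a b′))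
      ≡⟨ ⊕-interchange _ _ _ _ ⟩
    horner (x ∷ a) b ⊕ horner (x ∷ a) b′ ∎

  horner-·ʳ : ∀ {k} (a : Vec (Fin p) k) c b → horner a (c · b) ≡ c · horner a b
  horner-·ʳ []      c b = sym (·-zeroʳ (suc m) c)
  horner-·ʳ (x ∷ a) c b = begin
    x · c · b ⊕ mulλ (horner a (c · b))
      ≡⟨ cong₂ _⊕_ (·-commute x c b) (trans (cong mulλ (horner-·ʳ a c b)) (mulλ-· c _)) ⟩
    c · x · b ⊕ c · mulλ (horner a b)
      ≡⟨ ·-distrib-⊕ c _ _ ⟨
    c · horner (x ∷ a) b ∎
    where
    ·-commute : ∀ x c b → x · c · b ≡ c · x · b
    ·-commute x c b = trans (·-assoc x c b) (trans (cong (_· b) (ℤ/p.*-comm x c)) (sym (·-assoc c x b)))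

  horner-mulλ : ∀ {k} (a : Vec (Fin p) k) b → horner a (mulλ b) ≡ mulλ (horner a b)
  horner-mulλ []      b = sym mulλ-𝟘
  horner-mulλ (x ∷ a) b = begin
    x · mulλ b ⊕ mulλ (horner a (mulλ b))   ≡⟨ cong₂ _⊕_ (sym (mulλ-· x b)) (cong mulλ (horner-mulλ a b)) ⟩
    mulλ (x · b) ⊕ mulλ (mulλ (horner a b)) ≡⟨ mulλ-⊕ _ _ ⟨
    mulλ (horner (x ∷ a) b)                 ∎

  horner-comm : ∀ {k l} (a : Vec (Fin p) k) (a′ : Vec (Fin p) l) b → horner a (horner a′ b) ≡ horner a′ (horner a b)
  horner-comm []      a′ b = sym (horner-𝟘ʳ a′)
  horner-comm (x ∷ a) a′ b = begin
    x · horner a′ b ⊕ mulλ (horner a (horner a′ b))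
      ≡⟨ cong₂ _⊕_ (sym (horner-·ʳ a′ x b)) (trans (cong mulλ (horner-comm a a′ b)) (sym (horner-mulλ a′ _))) ⟩
    horner a′ (x · b) ⊕ horner a′ (mulλ (horner a b))
      ≡⟨ horner-⊕ʳ a′ _ _ ⟨
    horner a′ (horner (x ∷ a) b) ∎

  horner-oneˡ : ∀ b → horner oneF b ≡ b
  horner-oneˡ b = begin
    1ₘ · b ⊕ mulλ (horner (𝟘 {m}) b) ≡⟨ cong₂ _⊕_ (·-identityˡ b) (trans (cong mulλ (horner-𝟘ˡ m b)) mulλ-𝟘) ⟩
    b ⊕ 𝟘                            ≡⟨ ⊕-identityʳ b ⟩
    b                                ∎

  coeff-beyond : ∀ {k} (a : Vec (Fin p) k) j → k ≤ j → coeff (toList a) j ≡ 0ₘ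
  coeff-beyond []      j       _         = refl
  coeff-beyond (x ∷ a) (suc j) (s≤s k≤j) = coeff-beyond a j k≤j

  coeff-lookup : ∀ {k} (a : Vec (Fin p) k) i → coeff (toList a) (toℕ i) ≡ lookup a i
  coeff-lookup (x ∷ a) Fin.zero    = refl
  coeff-lookup (x ∷ a) (Fin.suc i) = coeff-lookup a i

  -- A polynomial of degree < f evaluated at λ is never reduced modulo F.
  lookup-horner-oneʳ : ∀ {k} (a : Vec (Fin p) k) → k ≤ suc m → ∀ i → lookup (horner a oneF) i ≡ coeff (toList a) (toℕ i)
  lookup-horner-oneʳ []              _         i = VecP.lookup-replicate i 0ₘ
  lookup-horner-oneʳ {suc k} (x ∷ a) (s≤s k≤m) i = begin
    lookup (x · oneF ⊕ mulλ v) i           ≡⟨ cong (λ u → lookup (x · oneF ⊕ u) i) (mulλ-shift v last-v) ⟩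
    lookup (x · oneF ⊕ (0ₘ ∷ init v)) i    ≡⟨ lookup-shifted i ⟩
    coeff (toList (x ∷ a)) (toℕ i)         ∎
    where
    v : El
    v = horner a oneF
    IH : ∀ i → lookup v i ≡ coeff (toList a) (toℕ i)
    IH = lookup-horner-oneʳ a (ℕP.m≤n⇒m≤1+n k≤m)
    last-v : last v ≡ 0ₘ
    last-v = begin
      last v                               ≡⟨ last-lookup v ⟩
      lookup v (Fin.fromℕ m)               ≡⟨ IH (Fin.fromℕ m) ⟩
      coeff (toList a) (toℕ (Fin.fromℕ m)) ≡⟨ cong (coeff (toList a)) (FinP.toℕ-fromℕ m) ⟩
      coeff (toList a) m                   ≡⟨ coeff-beyond a m k≤m ⟩
      0ₘ                                   ∎
    lookup-shifted : ∀ i → lookup (x · oneF ⊕ (0ₘ ∷ init v)) i ≡ coeff (toList (x ∷ a)) (toℕ i)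
    lookup-shifted Fin.zero    = trans (ℤ/p.+-identityʳ _) (ℤ/p.*-identityʳ x)
    lookup-shifted (Fin.suc i) = begin
      lookup (x · 𝟘 ⊕ init v) i            ≡⟨ cong (λ u → lookup (u ⊕ init v) i) (·-zeroʳ m x) ⟩
      lookup (𝟘 ⊕ init v) i                ≡⟨ cong (λ u → lookup u i) (⊕-identityˡ (init v)) ⟩
      lookup (init v) i                    ≡⟨ lookup-init v i ⟩
      lookup v (Fin.inject₁ i)             ≡⟨ IH (Fin.inject₁ i) ⟩
      coeff (toList a) (toℕ (Fin.inject₁ i)) ≡⟨ cong (coeff (toList a)) (FinP.toℕ-inject₁ i) ⟩
      coeff (toList a) (toℕ i)             ∎

  horner-oneʳ : ∀ a → horner a oneF ≡ a
  horner-oneʳ a = lookup-extensionality _ _ λ i → trans (lookup-horner-oneʳ a ℕP.≤-refl i) (coeff-lookup a i)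

  mulF-comm : ∀ a b → mulF a b ≡ mulF b a
  mulF-comm a b = begin
    horner a b                   ≡⟨ cong (horner a) (horner-oneʳ b) ⟨
    horner a (horner b oneF)     ≡⟨ horner-comm a b oneF ⟩
    horner b (horner a oneF)     ≡⟨ cong (horner b) (horner-oneʳ a) ⟩
    horner b a                   ∎

  mulF-assoc : ∀ a b c → mulF (mulF a b) c ≡ mulF a (mulF b c)
  mulF-assoc a b c = begin
    horner (horner a b) c        ≡⟨ mulF-comm (horner a b) c ⟩
    horner c (horner a b)        ≡⟨ horner-comm c a b ⟩
    horner a (horner c b)        ≡⟨ cong (horner a) (mulF-comm c b) ⟩
    horner a (horner b c)        ∎

  commutativeRing : CommutativeRing 0ℓ 0ℓ
  commutativeRing = record
    { Carrier = El ; _≈_ = _≡_ ; _+_ = addF ; _*_ = mulF ; -_ = negF ; 0# = zeroF ; 1# = oneF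
    ; isCommutativeRing = record
      { isRing = record
        { +-isAbelianGroup = AbelianGroup.isAbelianGroup (⊕-abelianGroup (suc m))
        ; *-cong = cong₂ mulF
        ; *-assoc = mulF-assoc
        ; *-identity = horner-oneˡ , horner-oneʳ
        ; distrib = horner-⊕ʳ , λ c a b → horner-⊕ˡ a b c
        }
      ; *-comm = mulF-comm
      }
    }

module ConstantTermPairing (p m : ℕ) .{{_ : NonZero p}} (p-prime : Prime p) (F : Vec (Fin p) (suc m))
                          (λ-primitive : FieldRep.PrimitiveF p m F) where

  open import Data.Nat as ℕ using (zero; suc; _≤_; _<_; _∸_; _^_; z≤n; s≤s; nonTrivial⇒n>1)
  open import Data.Nat.DivMod using (_%_; m<n⇒m%n≡m)
  import Data.Nat.Properties as ℕP
  open import Data.Nat.Divisibility using (_∣_; m%n≡0⇒n∣m; n∣m⇒m%n≡0)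
  open import Data.Nat.GeneralisedArithmetic using (iterate; fold; iterate-is-fold)
  open import Data.Nat.Primality using (euclidsLemma; prime⇒nonTrivial)
  open import Data.Fin as Fin using (toℕ; fromℕ<)
  import Data.Fin.Properties as FinP
  open import Data.Vec using ([]; _∷_; head; init; last)
  open import Data.Product using (_,_; proj₁; ∃)
  open import Data.Sum as Sum using (_⊎_; [_,_]′)
  open import Relation.Nullary using (¬_; contradiction)
  open import Algebra.Bundles using (CommutativeRing)
  open import Relation.Binary.PropositionalEquality
  open import Defs using (module Mod; module FieldRep)
  open Mod p
  open FieldRep p m F
  open ModularArithmetic p using (toℕ-reduce; toℕ-0ₘ)
  private module ℤ/p = CommutativeRing (ModularArithmetic.commutativeRing p)
  open Coordinatewise ℤ/p.isCommutativeRing using (𝟘; _⊕_; ⊖_; _·_)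
  open import Algebra.Properties.Ring ℤ/p.ring using (-0#≈0#; -‿injective)
  open PolynomialQuotient p m F using (horner; mulλ-shift; horner-mulλ; horner-oneˡ; horner-oneʳ; commutativeRing)
  open VecLemmas using (head-zipWith; head-map; init-last-injective; init-replicate; last-replicate)
  open import Function using (id)
  open CommutativeRing commutativeRing using () renaming (*-comm to mulF-comm; *-assoc to mulF-assoc)
  open ≡-Reasoning

  divisible⇒0ₘ : ∀ a → p ∣ toℕ a → a ≡ 0ₘ
  divisible⇒0ₘ a p∣a = FinP.toℕ-injective (begin
    toℕ a       ≡⟨ m<n⇒m%n≡m (FinP.toℕ<n a) ⟨
    toℕ a % p   ≡⟨ n∣m⇒m%n≡0 (toℕ a) p p∣a ⟩
    0           ≡⟨ toℕ-0ₘ ⟨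
    toℕ 0ₘ      ∎)

  *ₘ-zero-divisor : ∀ a b → a *ₘ b ≡ 0ₘ → a ≡ 0ₘ ⊎ b ≡ 0ₘ
  *ₘ-zero-divisor a b ab≡0 =
    Sum.map (divisible⇒0ₘ a) (divisible⇒0ₘ b) (euclidsLemma (toℕ a) (toℕ b) p-prime p∣ab)
    where
    p∣ab : p ∣ toℕ a ℕ.* toℕ b
    p∣ab = m%n≡0⇒n∣m _ p (trans (sym (toℕ-reduce _)) (trans (cong toℕ ab≡0) toℕ-0ₘ))

  1<p : 1 < p
  1<p = nonTrivial⇒n>1 p {{prime⇒nonTrivial p-prime}}

  1ₘ≢0ₘ : 1ₘ ≢ 0ₘ
  1ₘ≢0ₘ 1≡0 = contradiction (trans (sym toℕ-1ₘ) (trans (cong toℕ 1≡0) toℕ-0ₘ)) λ ()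
    where
    toℕ-1ₘ : toℕ 1ₘ ≡ 1
    toℕ-1ₘ = trans (toℕ-reduce 1) (m<n⇒m%n≡m 1<p)

  head-mulλ : ∀ s → head (mulλ s) ≡ -ₘ (last s *ₘ head F)
  head-mulλ s = begin
    head ((0ₘ ∷ init s) ⊕ ⊖ (last s · F))   ≡⟨ head-zipWith _+ₘ_ (0ₘ ∷ init s) (⊖ (last s · F)) ⟩
    0ₘ +ₘ head (⊖ (last s · F))             ≡⟨ ℤ/p.+-identityˡ _ ⟩
    head (⊖ (last s · F))                   ≡⟨ head-map -ₘ_ (last s · F) ⟩
    -ₘ head (last s · F)                    ≡⟨ cong -ₘ_ (head-map (last s *ₘ_) F) ⟩
    -ₘ (last s *ₘ head F)                   ∎

  mulF-λ : ∀ x → mulF λF x ≡ mulλ x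
  mulF-λ x = begin
    mulF λF x                ≡⟨ mulF-comm λF x ⟩
    horner x (mulλ oneF)     ≡⟨ horner-mulλ x oneF ⟩
    mulλ (horner x oneF)     ≡⟨ cong mulλ (horner-oneʳ x) ⟩
    mulλ x                   ∎

  mulF-powF-λ : ∀ j t → mulF (powF λF j) t ≡ fold t mulλ j
  mulF-powF-λ zero    t = horner-oneˡ t
  mulF-powF-λ (suc j) t = begin
    mulF (mulF λF (powF λF j)) t   ≡⟨ mulF-assoc λF (powF λF j) t ⟩
    mulF λF (mulF (powF λF j) t)   ≡⟨ mulF-λ _ ⟩
    mulλ (mulF (powF λF j) t)      ≡⟨ cong mulλ (mulF-powF-λ j t) ⟩
    mulλ (fold t mulλ j)           ∎

  -- λ is a unit since λ^(q-1) = 1, so λ ∤ F, i.e. F(0) ≠ 0.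
  head-F≢0ₘ : head F ≢ 0ₘ
  head-F≢0ₘ F₀≡0 = 1ₘ≢0ₘ (begin
    1ₘ                              ≡⟨ cong head (proj₁ λ-primitive) ⟨
    head (powF λF (p ^ suc m ∸ 1))  ≡⟨ cong (λ j → head (powF λF j)) (sym (ℕP.suc-pred (p ^ suc m ∸ 1))) ⟩
    head (mulF λF λᵏ)               ≡⟨ cong head (mulF-λ λᵏ) ⟩
    head (mulλ λᵏ)                  ≡⟨ head-mulλ λᵏ ⟩
    -ₘ (last λᵏ *ₘ head F)          ≡⟨ cong (λ c → -ₘ (last λᵏ *ₘ c)) F₀≡0 ⟩
    -ₘ (last λᵏ *ₘ 0ₘ)              ≡⟨ cong -ₘ_ (ℤ/p.zeroʳ (last λᵏ)) ⟩
    -ₘ 0ₘ                           ≡⟨ -0#≈0# ⟩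
    0ₘ                              ∎)
    where
    instance
      q-1≢0 : ℕ.NonZero (p ^ suc m ∸ 1)
      q-1≢0 = ℕ.>-nonZero (ℕP.m<n⇒0<n∸m (ℕP.^-monoʳ-< p 1<p {0} {suc m} (s≤s z≤n)))
    λᵏ : El
    λᵏ = powF λF (ℕ.pred (p ^ suc m ∸ 1))

  head-mulλ≡0⇒last≡0 : ∀ s → head (mulλ s) ≡ 0ₘ → last s ≡ 0ₘ
  head-mulλ≡0⇒last≡0 s h≡0 = [ id , (λ F₀≡0 → contradiction F₀≡0 head-F≢0ₘ) ]′
    (*ₘ-zero-divisor (last s) (head F) (-‿injective (begin
      -ₘ (last s *ₘ head F)   ≡⟨ head-mulλ s ⟨
      head (mulλ s)           ≡⟨ h≡0 ⟩
      0ₘ                      ≡⟨ -0#≈0# ⟨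
      -ₘ 0ₘ                   ∎)))

  shift : ∀ {k} → Vec (Fin p) (suc k) → Vec (Fin p) (suc k)
  shift v = 0ₘ ∷ init v

  iterate-shift-0∷ : ∀ {k} j (w : Vec (Fin p) (suc k)) → iterate shift (0ₘ ∷ w) j ≡ 0ₘ ∷ iterate shift w j
  iterate-shift-0∷ zero    w = refl
  iterate-shift-0∷ (suc j) w = iterate-shift-0∷ j (shift w)

  -- The j-th shift of s ends with its coefficient of index k ∸ j.
  lasts-of-shifts≡0⇒≡𝟘 : ∀ k (s : Vec (Fin p) (suc k)) → (∀ j → j ≤ k → last (iterate shift s j) ≡ 0ₘ) → s ≡ 𝟘
  lasts-of-shifts≡0⇒≡𝟘 zero    (x ∷ []) h = cong (_∷ []) (h 0 z≤n)
  lasts-of-shifts≡0⇒≡𝟘 (suc k) s        h =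
    init-last-injective s 𝟘 (trans (lasts-of-shifts≡0⇒≡𝟘 k (init s) h′) (sym (init-replicate (suc k) 0ₘ)))
                            (trans (h 0 z≤n) (sym (last-replicate (suc k) 0ₘ)))
    where
    h′ : ∀ j → j ≤ k → last (iterate shift (init s) j) ≡ 0ₘ
    h′ j j≤k = trans (cong last (sym (iterate-shift-0∷ j (init s)))) (h (suc j) (s≤s j≤k))

  -- head (λ·s) = 0 forces the top coefficient of s to vanish, and then λ·s is a plain shift.
  heads≡0⇒lasts-of-shifts≡0 : ∀ n s → (∀ j → j ≤ suc n → head (iterate mulλ s j) ≡ 0ₘ) →
                              ∀ j → j ≤ n → last (iterate shift s j) ≡ 0ₘ
  heads≡0⇒lasts-of-shifts≡0 n       s h zero    _         = head-mulλ≡0⇒last≡0 s (h 1 (s≤s z≤n))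
  heads≡0⇒lasts-of-shifts≡0 (suc n) s h (suc j) (s≤s j≤n) = begin
    last (iterate shift (shift s) j)  ≡⟨ cong (λ t → last (iterate shift t j)) (mulλ-shift s last-s) ⟨
    last (iterate shift (mulλ s) j)   ≡⟨ heads≡0⇒lasts-of-shifts≡0 n (mulλ s) (λ j′ j′≤ → h (suc j′) (s≤s j′≤)) j j≤n ⟩
    0ₘ                                ∎
    where
    last-s : last s ≡ 0ₘ
    last-s = head-mulλ≡0⇒last≡0 s (h 1 (s≤s z≤n))

  head-mulF-nondegenerate : ∀ t → t ≢ zeroF → ∃ λ c → head (mulF c t) ≢ 0ₘ
  head-mulF-nondegenerate t t≢0 with FinP.¬∀⟶∃¬ (suc (suc m)) P (λ i → head (iterate mulλ t (toℕ i)) FinP.≟ 0ₘ) ¬all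
    where
    P : Fin (suc (suc m)) → Set
    P i = head (iterate mulλ t (toℕ i)) ≡ 0ₘ
    ¬all : ¬ (∀ i → P i)
    ¬all all = t≢0 (lasts-of-shifts≡0⇒≡𝟘 m t (heads≡0⇒lasts-of-shifts≡0 m t λ j j≤ →
      subst (λ i → head (iterate mulλ t i) ≡ 0ₘ) (FinP.toℕ-fromℕ< (s≤s j≤)) (all (fromℕ< (s≤s j≤)))))
  ... | i , head≢0 = powF λF (toℕ i) , λ head≡0 → head≢0 (begin
    head (iterate mulλ t (toℕ i))     ≡⟨ cong head (iterate-is-fold t mulλ (toℕ i)) ⟨
    head (fold t mulλ (toℕ i))        ≡⟨ cong head (mulF-powF-λ (toℕ i) t) ⟨
    head (mulF (powF λF (toℕ i)) t)   ≡⟨ head≡0 ⟩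
    0ₘ                                ∎)

open import Algebra.Bundles using (CommutativeRing)

module Enumeration where

  open import Data.Nat using (ℕ; zero; suc; _+_; _*_)
  open import Data.Nat.ListAction using (sum)
  open import Data.Bool using (true; false; if_then_else_)
  open import Data.List as List using (List; []; _∷_; _++_; concatMap)
  import Data.List.Properties as ListP
  open import Data.List.Membership.Propositional using (_∈_)
  open import Data.List.Relation.Unary.Any using (here; there)
  open import Data.Fin as Fin using (Fin)
  import Data.Fin.Properties as FinP
  open import Data.Vec using ([]; _∷_)
  import Data.Vec.Properties as VecP
  open import Data.Product using (_×_; _,_; proj₁; proj₂)
  import Data.Product.Properties as ProdP
  open import Function using (id; _∘_)
  open import Relation.Binary.Definitions using (DecidableEquality)
  open import Relation.Nullary using (yes; no; does; contradiction)
  open import Relation.Binary.PropositionalEquality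
  open import Defs using (allVecs)
  open ≡-Reasoning

  private variable
    A B : Set

  multiplicity : DecidableEquality A → A → List A → ℕ
  multiplicity _≟_ t []       = 0
  multiplicity _≟_ t (x ∷ xs) = if does (x ≟ t) then suc (multiplicity _≟_ t xs) else multiplicity _≟_ t xs

  IsEnumeration : DecidableEquality A → List A → Set
  IsEnumeration _≟_ xs = ∀ t → multiplicity _≟_ t xs ≡ 1

  module _ (_≟_ : DecidableEquality A) where

    multiplicity-++ : ∀ t xs ys → multiplicity _≟_ t (xs ++ ys) ≡ multiplicity _≟_ t xs + multiplicity _≟_ t ys
    multiplicity-++ t []       ys = refl
    multiplicity-++ t (x ∷ xs) ys with does (x ≟ t)
    ... | true  = cong suc (multiplicity-++ t xs ys)
    ... | false = multiplicity-++ t xs ys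

    multiplicity-concatMap : ∀ (L : B → List A) t xs →
                             multiplicity _≟_ t (concatMap L xs) ≡ sum (List.map (λ b → multiplicity _≟_ t (L b)) xs)
    multiplicity-concatMap L t []       = refl
    multiplicity-concatMap L t (x ∷ xs) =
      trans (multiplicity-++ t (L x) _) (cong (multiplicity _≟_ t (L x) +_) (multiplicity-concatMap L t xs))

    multiplicity-map-∉ : ∀ (f : B → A) t → (∀ b → f b ≢ t) → ∀ xs → multiplicity _≟_ t (List.map f xs) ≡ 0
    multiplicity-map-∉ f t ∉ []       = refl
    multiplicity-map-∉ f t ∉ (x ∷ xs) with f x ≟ t
    ... | yes fx≡t = contradiction fx≡t (∉ x)
    ... | no  _    = multiplicity-map-∉ f t ∉ xs

    sum-supported-at : ∀ (_≟ᴮ_ : DecidableEquality B) (G : B → ℕ) b₀ → (∀ b → b ≢ b₀ → G b ≡ 0) →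
                       ∀ xs → sum (List.map G xs) ≡ multiplicity _≟ᴮ_ b₀ xs * G b₀
    sum-supported-at _≟ᴮ_ G b₀ supp []       = refl
    sum-supported-at _≟ᴮ_ G b₀ supp (x ∷ xs) with x ≟ᴮ b₀
    ... | yes refl = cong (G x +_) (sum-supported-at _≟ᴮ_ G b₀ supp xs)
    ... | no  x≢b₀ = trans (cong (_+ sum (List.map G xs)) (supp x x≢b₀)) (sum-supported-at _≟ᴮ_ G b₀ supp xs)

    multiplicity-concatMap-≡1 : ∀ (_≟ᴮ_ : DecidableEquality B) (L : B → List A) t b₀ xs →
      multiplicity _≟ᴮ_ b₀ xs ≡ 1 → (∀ b → b ≢ b₀ → multiplicity _≟_ t (L b) ≡ 0) →
      multiplicity _≟_ t (L b₀) ≡ 1 → multiplicity _≟_ t (concatMap L xs) ≡ 1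
    multiplicity-concatMap-≡1 _≟ᴮ_ L t b₀ xs once elsewhere once-in-L₀ = begin
      multiplicity _≟_ t (concatMap L xs)                   ≡⟨ multiplicity-concatMap L t xs ⟩
      sum (List.map (λ b → multiplicity _≟_ t (L b)) xs)    ≡⟨ sum-supported-at _≟ᴮ_ _ b₀ elsewhere xs ⟩
      multiplicity _≟ᴮ_ b₀ xs * multiplicity _≟_ t (L b₀)   ≡⟨ cong₂ _*_ once once-in-L₀ ⟩
      1                                                     ∎

    multiplicity-concatMap-≡0 : ∀ (L : B → List A) t → (∀ b → multiplicity _≟_ t (L b) ≡ 0) →
                                ∀ xs → multiplicity _≟_ t (concatMap L xs) ≡ 0
    multiplicity-concatMap-≡0 L t none []       = refl
    multiplicity-concatMap-≡0 L t none (x ∷ xs) =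
      trans (multiplicity-++ t (L x) _) (cong₂ _+_ (none x) (multiplicity-concatMap-≡0 L t none xs))

    isEnumeration⇒∈ : ∀ {xs} → IsEnumeration _≟_ xs → ∀ t → t ∈ xs
    isEnumeration⇒∈ {xs} enum t = go xs (enum t)
      where
      go : ∀ xs → multiplicity _≟_ t xs ≡ 1 → t ∈ xs
      go (x ∷ xs) once with x ≟ t
      ... | yes refl = here refl
      ... | no  _    = there (go xs once)

  multiplicity-map-injective : ∀ (_≟ᴬ_ : DecidableEquality A) (_≟ᴮ_ : DecidableEquality B) (f : A → B) →
    (∀ {a a′} → f a ≡ f a′ → a ≡ a′) → ∀ t xs → multiplicity _≟ᴮ_ (f t) (List.map f xs) ≡ multiplicity _≟ᴬ_ t xs
  multiplicity-map-injective _≟ᴬ_ _≟ᴮ_ f inj t []       = refl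
  multiplicity-map-injective _≟ᴬ_ _≟ᴮ_ f inj t (x ∷ xs) with f x ≟ᴮ f t | x ≟ᴬ t
  ... | yes _   | yes _   = cong suc (multiplicity-map-injective _≟ᴬ_ _≟ᴮ_ f inj t xs)
  ... | no  _   | no  _   = multiplicity-map-injective _≟ᴬ_ _≟ᴮ_ f inj t xs
  ... | yes fx≡ | no  x≢  = contradiction (inj fx≡) x≢
  ... | no  fx≢ | yes x≡  = contradiction (cong f x≡) fx≢

  allFin-isEnumeration : ∀ n → IsEnumeration FinP._≟_ (List.allFin n)
  allFin-isEnumeration (suc n) t = begin
    multiplicity FinP._≟_ t (List.allFin (suc n))                      ≡⟨ cong (λ xs → multiplicity FinP._≟_ t (Fin.zero ∷ xs)) (sym (ListP.map-tabulate id Fin.suc)) ⟩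
    multiplicity FinP._≟_ t (Fin.zero ∷ List.map Fin.suc (List.allFin n)) ≡⟨ split t ⟩
    1                                                                  ∎
    where
    split : ∀ t → multiplicity FinP._≟_ t (Fin.zero ∷ List.map Fin.suc (List.allFin n)) ≡ 1
    split Fin.zero    = cong suc (multiplicity-map-∉ FinP._≟_ Fin.suc Fin.zero (λ _ ()) (List.allFin n))
    split (Fin.suc t) = trans (multiplicity-map-injective FinP._≟_ FinP._≟_ Fin.suc FinP.suc-injective t (List.allFin n))
                              (allFin-isEnumeration n t)

  allVecs-isEnumeration : ∀ (_≟_ : DecidableEquality A) {xs} → IsEnumeration _≟_ xs →
                          ∀ n → IsEnumeration (VecP.≡-dec _≟_) (allVecs xs n)
  allVecs-isEnumeration _≟_ enum zero    []       = refl
  allVecs-isEnumeration _≟_ {xs} enum (suc n) (t ∷ ts) =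
    multiplicity-concatMap-≡1 (VecP.≡-dec _≟_) _≟_ (λ a → List.map (a ∷_) (allVecs xs n)) (t ∷ ts) t xs (enum t)
      (λ a a≢t → multiplicity-map-∉ (VecP.≡-dec _≟_) (a ∷_) (t ∷ ts) (λ v e → a≢t (VecP.∷-injectiveˡ e)) (allVecs xs n))
      (trans (multiplicity-map-injective (VecP.≡-dec _≟_) (VecP.≡-dec _≟_) (t ∷_) VecP.∷-injectiveʳ ts (allVecs xs n))
             (allVecs-isEnumeration _≟_ enum n ts))

  triples-isEnumeration : ∀ {A : Set} (_≟_ : DecidableEquality A) {xs} → IsEnumeration _≟_ xs →
    IsEnumeration (ProdP.≡-dec _≟_ (ProdP.≡-dec _≟_ _≟_))
      (concatMap (λ a → concatMap (λ b → List.map (λ c → (a , b , c)) xs) xs) xs)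
  triples-isEnumeration {A} _≟_ {xs} enum t@(t₁ , t₂ , t₃) =
    multiplicity-concatMap-≡1 _≟³_ _≟_ _ t t₁ xs (enum t₁)
      (λ a a≢t₁ → multiplicity-concatMap-≡0 _≟³_ _ t
        (λ b → multiplicity-map-∉ _≟³_ _ t (λ c e → a≢t₁ (cong proj₁ e)) xs) xs)
      (multiplicity-concatMap-≡1 _≟³_ _≟_ _ t t₂ xs (enum t₂)
        (λ b b≢t₂ → multiplicity-map-∉ _≟³_ _ t (λ c e → b≢t₂ (cong (proj₁ ∘ proj₂) e)) xs)
        (trans (multiplicity-map-injective _≟_ _≟³_ (λ c → (t₁ , t₂ , c)) (cong (proj₂ ∘ proj₂)) t₃ xs) (enum t₃)))
    where
    _≟³_ : DecidableEquality (A × A × A)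
    _≟³_ = ProdP.≡-dec _≟_ (ProdP.≡-dec _≟_ _≟_)

module BigOperators {c ℓ} (S : CommutativeRing c ℓ) where

  open import Data.Nat as ℕ using (ℕ; zero; suc; NonZero)
  open import Data.Nat.DivMod using (_%_; _/_; m≡m%n+[m/n]*n)
  open import Data.Bool using (Bool; true; false; if_then_else_)
  open import Data.List as List using (List; []; _∷_; _++_; concatMap)
  open import Data.Vec as Vec using (Vec; []; _∷_; toList)
  open import Data.Product using (_,_; uncurry)
  open import Function using (_∘_)
  open import Relation.Binary.Definitions using (DecidableEquality)
  open import Relation.Nullary using (yes; no; does; contradiction)
  import Relation.Binary.PropositionalEquality as ≡
  open ≡ using (_≡_; _≢_)
  open import Algebra.Properties.CommutativeSemigroup (CommutativeRing.+-commutativeSemigroup S)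
    using () renaming (interchange to +-interchange)
  open import Algebra.Properties.CommutativeSemigroup (CommutativeRing.*-commutativeSemigroup S)
    using () renaming (interchange to *-interchange) public
  open import Defs using (allVecs; module InRing)
  open Enumeration
  open CommutativeRing S
  open InRing S
  open import Relation.Binary.Reasoning.Setoid setoid

  private variable
    A B : Set

  ≡⇒≈ : ∀ {a b} → a ≡ b → a ≈ b
  ≡⇒≈ ≡.refl = refl

  Σ-cong : ∀ (xs : List A) {f g : A → Carrier} → (∀ a → f a ≈ g a) → Σ xs f ≈ Σ xs g
  Σ-cong []       f≈g = refl
  Σ-cong (x ∷ xs) f≈g = +-cong (f≈g x) (Σ-cong xs f≈g)

  Π-cong : ∀ (xs : List A) {f g : A → Carrier} → (∀ a → f a ≈ g a) → Π xs f ≈ Π xs g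
  Π-cong []       f≈g = refl
  Π-cong (x ∷ xs) f≈g = *-cong (f≈g x) (Π-cong xs f≈g)

  Σ-++ : ∀ (xs ys : List A) f → Σ (xs ++ ys) f ≈ Σ xs f + Σ ys f
  Σ-++ []       ys f = sym (+-identityˡ _)
  Σ-++ (x ∷ xs) ys f = trans (+-congˡ (Σ-++ xs ys f)) (sym (+-assoc _ _ _))

  Σ-0# : ∀ (xs : List A) {f} → (∀ a → f a ≈ 0#) → Σ xs f ≈ 0#
  Σ-0# []       f≈0 = refl
  Σ-0# (x ∷ xs) f≈0 = trans (+-cong (f≈0 x) (Σ-0# xs f≈0)) (+-identityˡ 0#)

  Π-1# : ∀ (xs : List A) {f} → (∀ a → f a ≈ 1#) → Π xs f ≈ 1#
  Π-1# []       f≈1 = refl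
  Π-1# (x ∷ xs) f≈1 = trans (*-cong (f≈1 x) (Π-1# xs f≈1)) (*-identityˡ 1#)

  Σ-+ : ∀ (xs : List A) f g → Σ xs (λ a → f a + g a) ≈ Σ xs f + Σ xs g
  Σ-+ []       f g = sym (+-identityˡ 0#)
  Σ-+ (x ∷ xs) f g = trans (+-congˡ (Σ-+ xs f g)) (+-interchange _ _ _ _)

  Π-* : ∀ (xs : List A) f g → Π xs (λ a → f a * g a) ≈ Π xs f * Π xs g
  Π-* []       f g = sym (*-identityˡ 1#)
  Π-* (x ∷ xs) f g = trans (*-congˡ (Π-* xs f g)) (*-interchange _ _ _ _)

  *-distribˡ-Σ : ∀ (xs : List A) k f → k * Σ xs f ≈ Σ xs (λ a → k * f a)
  *-distribˡ-Σ []       k f = zeroʳ k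
  *-distribˡ-Σ (x ∷ xs) k f = trans (distribˡ k _ _) (+-congˡ (*-distribˡ-Σ xs k f))

  *-distribʳ-Σ : ∀ (xs : List A) k f → Σ xs f * k ≈ Σ xs (λ a → f a * k)
  *-distribʳ-Σ xs k f = trans (*-comm _ k) (trans (*-distribˡ-Σ xs k f) (Σ-cong xs λ a → *-comm k (f a)))

  Σ-filterᵇ : ∀ (P : A → Bool) xs f → Σ (List.filterᵇ P xs) f ≈ Σ xs (λ a → if P a then f a else 0#)
  Σ-filterᵇ P []       f = refl
  Σ-filterᵇ P (x ∷ xs) f with P x
  ... | true  = +-congˡ (Σ-filterᵇ P xs f)
  ... | false = trans (Σ-filterᵇ P xs f) (sym (+-identityˡ _))

  Σ-filterᵇ-cong : ∀ (P : A → Bool) xs {f g} → (∀ a → P a ≡ true → f a ≈ g a) →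
                  Σ (List.filterᵇ P xs) f ≈ Σ (List.filterᵇ P xs) g
  Σ-filterᵇ-cong P []       f≈g = refl
  Σ-filterᵇ-cong P (x ∷ xs) f≈g with P x in Px
  ... | true  = +-cong (f≈g x Px) (Σ-filterᵇ-cong P xs f≈g)
  ... | false = Σ-filterᵇ-cong P xs f≈g

  Σ-map : ∀ (g : A → B) xs f → Σ (List.map g xs) f ≈ Σ xs (f ∘ g)
  Σ-map g []       f = refl
  Σ-map g (x ∷ xs) f = +-congˡ (Σ-map g xs f)

  Σ-concatMap : ∀ (g : A → List B) xs f → Σ (concatMap g xs) f ≈ Σ xs (λ a → Σ (g a) f)
  Σ-concatMap g []       f = refl
  Σ-concatMap g (x ∷ xs) f = trans (Σ-++ (g x) _ f) (+-congˡ (Σ-concatMap g xs f))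

  Σ-comm : ∀ (xs : List A) (ys : List B) (f : A → B → Carrier) → Σ xs (λ a → Σ ys (f a)) ≈ Σ ys (λ b → Σ xs (λ a → f a b))
  Σ-comm []       ys f = sym (Σ-0# ys λ _ → refl)
  Σ-comm (x ∷ xs) ys f = trans (+-congˡ (Σ-comm xs ys f)) (sym (Σ-+ ys (f x) _))

  Σ-*-comm : ∀ (xs : List A) (ys : List B) (g : A → B → Carrier) (f : A → Carrier) →
             Σ xs (λ a → Σ ys (g a) * f a) ≈ Σ ys (λ b → Σ xs (λ a → g a b * f a))
  Σ-*-comm xs ys g f = trans (Σ-cong xs λ a → *-distribʳ-Σ ys (f a) (g a)) (Σ-comm xs ys λ a b → g a b * f a)

  Σ²-comm : ∀ {C D : Set} (xs : List A) (ys : List B) (zs : List C) (ts : List D) (f : A → B → C → D → Carrier) →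
            Σ xs (λ a → Σ ys (λ b → Σ zs (λ c → Σ ts (f a b c)))) ≈
            Σ zs (λ c → Σ ts (λ d → Σ xs (λ a → Σ ys (λ b → f a b c d))))
  Σ²-comm xs ys zs ts f = begin
    Σ xs (λ a → Σ ys (λ b → Σ zs (λ c → Σ ts (f a b c))))      ≈⟨ Σ-cong xs (λ a → Σ-comm ys zs _) ⟩
    Σ xs (λ a → Σ zs (λ c → Σ ys (λ b → Σ ts (f a b c))))      ≈⟨ Σ-cong xs (λ a → Σ-cong zs (λ c → Σ-comm ys ts _)) ⟩
    Σ xs (λ a → Σ zs (λ c → Σ ts (λ d → Σ ys (λ b → f a b c d)))) ≈⟨ Σ-comm xs zs _ ⟩
    Σ zs (λ c → Σ xs (λ a → Σ ts (λ d → Σ ys (λ b → f a b c d)))) ≈⟨ Σ-cong zs (λ c → Σ-comm xs ts _) ⟩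
    Σ zs (λ c → Σ ts (λ d → Σ xs (λ a → Σ ys (λ b → f a b c d)))) ∎

  Σ-*-Σ-* : ∀ (xs : List A) (ys : List B) f g k → (Σ xs f * Σ ys g) * k ≈ Σ xs (λ a → Σ ys (λ b → (f a * g b) * k))
  Σ-*-Σ-* xs ys f g k = begin
    (Σ xs f * Σ ys g) * k                     ≈⟨ *-congʳ (*-distribʳ-Σ xs _ f) ⟩
    Σ xs (λ a → f a * Σ ys g) * k             ≈⟨ *-distribʳ-Σ xs k _ ⟩
    Σ xs (λ a → (f a * Σ ys g) * k)           ≈⟨ Σ-cong xs (λ a → *-congʳ (*-distribˡ-Σ ys (f a) g)) ⟩
    Σ xs (λ a → Σ ys (λ b → f a * g b) * k)   ≈⟨ Σ-cong xs (λ a → *-distribʳ-Σ ys k _) ⟩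
    Σ xs (λ a → Σ ys (λ b → (f a * g b) * k)) ∎

  ·ₙ-cong : ∀ n {a b} → a ≈ b → n ·ₙ a ≈ n ·ₙ b
  ·ₙ-cong zero    a≈b = refl
  ·ₙ-cong (suc n) a≈b = +-cong a≈b (·ₙ-cong n a≈b)

  ·ₙ-0# : ∀ n → n ·ₙ 0# ≈ 0#
  ·ₙ-0# zero    = refl
  ·ₙ-0# (suc n) = trans (+-identityˡ _) (·ₙ-0# n)

  ·ₙ-assoc-* : ∀ n a b → (n ·ₙ a) * b ≈ n ·ₙ (a * b)
  ·ₙ-assoc-* zero    a b = zeroˡ b
  ·ₙ-assoc-* (suc n) a b = trans (distribʳ b a _) (+-congˡ (·ₙ-assoc-* n a b))

  ·ₙ-1#-* : ∀ n a → (n ·ₙ 1#) * a ≈ n ·ₙ a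
  ·ₙ-1#-* n a = trans (·ₙ-assoc-* n 1# a) (·ₙ-cong n (*-identityˡ a))

  ·ₙ-distrib-+ : ∀ m n a → (m ℕ.+ n) ·ₙ a ≈ m ·ₙ a + n ·ₙ a
  ·ₙ-distrib-+ zero    n a = sym (+-identityˡ _)
  ·ₙ-distrib-+ (suc m) n a = trans (+-congˡ (·ₙ-distrib-+ m n a)) (sym (+-assoc _ _ _))

  ·ₙ-·ₙ : ∀ m n a → (m ℕ.* n) ·ₙ a ≈ m ·ₙ (n ·ₙ a)
  ·ₙ-·ₙ zero    n a = refl
  ·ₙ-·ₙ (suc m) n a = trans (·ₙ-distrib-+ n (m ℕ.* n) a) (+-congˡ (·ₙ-·ₙ m n a))

  ·ₙ-distrib-Σ : ∀ n (xs : List A) f → n ·ₙ Σ xs f ≈ Σ xs (λ a → n ·ₙ f a)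
  ·ₙ-distrib-Σ zero    xs f = sym (Σ-0# xs λ _ → refl)
  ·ₙ-distrib-Σ (suc n) xs f = trans (+-congˡ (·ₙ-distrib-Σ n xs f)) (sym (Σ-+ xs f _))

  Σ-1# : ∀ (xs : List A) → Σ xs (λ _ → 1#) ≈ List.length xs ·ₙ 1#
  Σ-1# []       = refl
  Σ-1# (x ∷ xs) = +-congˡ (Σ-1# xs)

  pow-cong : ∀ n {a b} → a ≈ b → pow a n ≈ pow b n
  pow-cong zero    a≈b = refl
  pow-cong (suc n) a≈b = *-cong a≈b (pow-cong n a≈b)

  pow-+ : ∀ a m n → pow a (m ℕ.+ n) ≈ pow a m * pow a n
  pow-+ a zero    n = sym (*-identityˡ _)
  pow-+ a (suc m) n = trans (*-congˡ (pow-+ a m n)) (sym (*-assoc _ _ _))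

  pow-* : ∀ a m n → pow a (m ℕ.* n) ≈ pow (pow a n) m
  pow-* a zero    n = refl
  pow-* a (suc m) n = trans (pow-+ a n (m ℕ.* n)) (*-congˡ (pow-* a m n))

  pow-1# : ∀ m → pow 1# m ≈ 1#
  pow-1# zero    = refl
  pow-1# (suc m) = trans (*-identityˡ _) (pow-1# m)

  pow-root-% : ∀ N .{{_ : NonZero N}} {ζ} → pow ζ N ≈ 1# → ∀ m → pow ζ (m % N) ≈ pow ζ m
  pow-root-% N {ζ} ζᴺ≈1 m = sym (begin
    pow ζ m                                  ≈⟨ ≡⇒≈ (≡.cong (pow ζ) (m≡m%n+[m/n]*n m N)) ⟩
    pow ζ (m % N ℕ.+ (m / N) ℕ.* N)          ≈⟨ pow-+ ζ (m % N) _ ⟩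
    pow ζ (m % N) * pow ζ ((m / N) ℕ.* N)    ≈⟨ *-congˡ (pow-* ζ (m / N) N) ⟩
    pow ζ (m % N) * pow (pow ζ N) (m / N)    ≈⟨ *-congˡ (trans (pow-cong (m / N) ζᴺ≈1) (pow-1# (m / N))) ⟩
    pow ζ (m % N) * 1#                       ≈⟨ *-identityʳ _ ⟩
    pow ζ (m % N)                            ∎)

  module _ (_≟_ : DecidableEquality A) where

    Σ-supported-at : ∀ t f → (∀ a → a ≢ t → f a ≈ 0#) → ∀ xs → Σ xs f ≈ multiplicity _≟_ t xs ·ₙ f t
    Σ-supported-at t f supp []       = refl
    Σ-supported-at t f supp (x ∷ xs) with x ≟ t
    ... | yes ≡.refl = +-congˡ (Σ-supported-at t f supp xs)
    ... | no  x≢t    = trans (+-congʳ (supp x x≢t)) (trans (+-identityˡ _) (Σ-supported-at t f supp xs))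

    Π-supported-at : ∀ t f → (∀ a → a ≢ t → f a ≈ 1#) → ∀ xs → Π xs f ≈ pow (f t) (multiplicity _≟_ t xs)
    Π-supported-at t f supp []       = refl
    Π-supported-at t f supp (x ∷ xs) with x ≟ t
    ... | yes ≡.refl = *-congˡ (Π-supported-at t f supp xs)
    ... | no  x≢t    = trans (*-congʳ (supp x x≢t)) (trans (*-identityˡ _) (Π-supported-at t f supp xs))

    module _ {xs : List A} (enum : IsEnumeration _≟_ xs) where

      Σ-enumeration-supported-at : ∀ t f → (∀ a → a ≢ t → f a ≈ 0#) → Σ xs f ≈ f t
      Σ-enumeration-supported-at t f supp = begin
        Σ xs f                            ≈⟨ Σ-supported-at t f supp xs ⟩
        multiplicity _≟_ t xs ·ₙ f t      ≈⟨ ≡⇒≈ (≡.cong (_·ₙ f t) (enum t)) ⟩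
        f t + 0#                          ≈⟨ +-identityʳ (f t) ⟩
        f t                               ∎

      -- Both sides equal Σₐ Σ_b [b = φ a] g b, summed in the two orders.
      Σ-reindex : (φ ψ : A → A) → (∀ a → ψ (φ a) ≡ a) → (∀ b → φ (ψ b) ≡ b) → ∀ g → Σ xs (g ∘ φ) ≈ Σ xs g
      Σ-reindex φ ψ ψφ φψ g = begin
        Σ xs (g ∘ φ)                        ≈⟨ Σ-cong xs (λ a → δ-on (φ a) a ≡.refl) ⟨
        Σ xs (λ a → δ (φ a) a)              ≈⟨ Σ-cong xs (λ a → Σ-enumeration-supported-at (φ a) (λ b → δ b a) (λ b → δ-off b a)) ⟨
        Σ xs (λ a → Σ xs (λ b → δ b a))     ≈⟨ Σ-comm xs xs (λ a b → δ b a) ⟩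
        Σ xs (λ b → Σ xs (δ b))             ≈⟨ Σ-cong xs (λ b → Σ-enumeration-supported-at (ψ b) (δ b) (δ-off′ b)) ⟩
        Σ xs (λ b → δ b (ψ b))              ≈⟨ Σ-cong xs (λ b → δ-on b (ψ b) (≡.sym (φψ b))) ⟩
        Σ xs g                              ∎
        where
        δ : A → A → Carrier
        δ b a = if does (b ≟ φ a) then g b else 0#
        δ-off : ∀ b a → b ≢ φ a → δ b a ≈ 0#
        δ-off b a b≢ with b ≟ φ a
        ... | yes b≡ = contradiction b≡ b≢
        ... | no  _  = refl
        δ-off′ : ∀ b a → a ≢ ψ b → δ b a ≈ 0#
        δ-off′ b a a≢ = δ-off b a λ b≡ → a≢ (≡.trans (≡.sym (ψφ a)) (≡.cong ψ (≡.sym b≡)))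
        δ-on : ∀ b a → b ≡ φ a → δ b a ≈ g b
        δ-on b a b≡ with b ≟ φ a
        ... | yes _  = refl
        ... | no  b≢ = contradiction b≡ b≢

      Π-enumeration-supported-at : ∀ t f → (∀ a → a ≢ t → f a ≈ 1#) → Π xs f ≈ f t
      Π-enumeration-supported-at t f supp = begin
        Π xs f                            ≈⟨ Π-supported-at t f supp xs ⟩
        pow (f t) (multiplicity _≟_ t xs) ≈⟨ ≡⇒≈ (≡.cong (pow (f t)) (enum t)) ⟩
        f t * 1#                          ≈⟨ *-identityʳ (f t) ⟩
        f t                               ∎

      Π-pow-count : ∀ y ts → Π xs (λ a → pow (y a) (List.length (List.filterᵇ (λ t → does (t ≟ a)) ts))) ≈ Π ts y
      Π-pow-count y []       = Π-1# xs λ _ → refl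
      Π-pow-count y (t ∷ ts) = begin
        Π xs (λ a → pow (y a) (count a (t ∷ ts)))           ≈⟨ Π-cong xs split ⟩
        Π xs (λ a → [ t ≟ a ] y a * pow (y a) (count a ts)) ≈⟨ Π-* xs _ _ ⟩
        Π xs (λ a → [ t ≟ a ] y a) * Π xs (λ a → pow (y a) (count a ts))
          ≈⟨ *-cong (Π-enumeration-supported-at t _ off) (Π-pow-count y ts) ⟩
        [ t ≟ t ] y t * Π ts y                              ≈⟨ *-congʳ on ⟩
        y t * Π ts y                                        ∎
        where
        count : A → List A → ℕ
        count a = List.length ∘ List.filterᵇ (λ t → does (t ≟ a))
        [_≟_]_ : A → A → Carrier → Carrier
        [ t ≟ a ] r = if does (t ≟ a) then r else 1#
        split : ∀ a → pow (y a) (count a (t ∷ ts)) ≈ [ t ≟ a ] y a * pow (y a) (count a ts)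
        split a with t ≟ a
        ... | yes _ = refl
        ... | no  _ = sym (*-identityˡ _)
        off : ∀ a → a ≢ t → [ t ≟ a ] y a ≈ 1#
        off a a≢t with t ≟ a
        ... | yes t≡a = contradiction (≡.sym t≡a) a≢t
        ... | no  _   = refl
        on : [ t ≟ t ] y t ≈ y t
        on with t ≟ t
        ... | yes _   = refl
        ... | no  t≢t = contradiction ≡.refl t≢t

  Π-Σ-expand : ∀ {B X : Set} (L : List B) (F : X → B → Carrier) {n} (z : Vec X n) →
               Π (toList z) (λ x → Σ L (F x)) ≈ Σ (allVecs L n) (λ bs → Π (toList (Vec.zip z bs)) (uncurry F))
  Π-Σ-expand L F []                   = sym (+-identityʳ 1#)
  Π-Σ-expand {B} L F {suc n} (x ∷ z) = begin
    Σ L (F x) * Π (toList z) (λ x → Σ L (F x))            ≈⟨ *-congˡ (Π-Σ-expand L F z) ⟩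
    Σ L (F x) * Σ (allVecs L n) G                         ≈⟨ *-distribʳ-Σ L _ (F x) ⟩
    Σ L (λ b → F x b * Σ (allVecs L n) G)                 ≈⟨ Σ-cong L (λ b → *-distribˡ-Σ (allVecs L n) (F x b) G) ⟩
    Σ L (λ b → Σ (allVecs L n) (λ bs → F x b * G bs))     ≈⟨ Σ-cong L (λ b → Σ-map (b ∷_) (allVecs L n) G′) ⟨
    Σ L (λ b → Σ (List.map (b ∷_) (allVecs L n)) G′)      ≈⟨ Σ-concatMap (λ b → List.map (b ∷_) (allVecs L n)) L G′ ⟨
    Σ (allVecs L (suc n)) G′                              ∎
    where
    G : Vec B n → Carrier
    G bs = Π (toList (Vec.zip z bs)) (uncurry F)
    G′ : Vec B (suc n) → Carrier
    G′ bs = Π (toList (Vec.zip (x ∷ z) bs)) (uncurry F)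

open import Data.Nat as ℕ using (ℕ; NonZero; _<_)
open import Data.Nat.DivMod using (_%_)
open import Data.Bool using (true)
open import Data.Vec as Vec using ()
open import Data.Product using (_×_; ∃)
open import Algebra.Bundles using (CommutativeRing)
open import Algebra.Structures using (IsCommutativeRing)
open import Relation.Binary.PropositionalEquality using (_≡_; _≢_)
open import Defs
open Enumeration using (IsEnumeration)

-- What the character-sum argument needs to know about 𝔑 and χ.
record Admissible (σ : Spec) : Set where
  field
    elems-isEnumeration : IsEnumeration (_≟ᴿ_ σ) (elems σ)
    oneR                : El σ
    isCommutativeRing   : IsCommutativeRing _≡_ (addR σ) (mulR σ) (negR σ) (zeroR σ) oneR
    ord-nonZero         : NonZero (ord σ)
    chiExp-+            : ∀ a b → chiExp σ (addR σ a b) ≡ ((chiExp σ a ℕ.+ chiExp σ b) % ord σ) {{ord-nonZero}}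
    chiExp-0            : chiExp σ (zeroR σ) ≡ 0
    chiExp-<            : ∀ a → chiExp σ a < ord σ
    linear-+            : ∀ {n} {C : Code σ n} → IsLinear σ C → ∀ {u v} → C u ≡ true → C v ≡ true →
                          C (Vec.zipWith (addR σ) u v) ≡ true
    linear-neg          : ∀ {n} {C : Code σ n} → IsLinear σ C → ∀ {u} → C u ≡ true → C (Vec.map (negR σ) u) ≡ true
    χ-nontrivial        : ∀ {n} {C : Code σ n} → IsLinear σ C → ∀ {u b} → C u ≡ true → dot σ u b ≢ zeroR σ →
                          ∃ λ u′ → C u′ ≡ true × chiExp σ (dot σ u′ b) ≢ 0

module CharacterSums {c ℓ} (S : CommutativeRing c ℓ) {σ : Spec} (adm : Admissible σ)
  (ζ : CommutativeRing.Carrier S)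
  (ζᴺ≈1 : CommutativeRing._≈_ S (InRing.pow S ζ (ord σ)) (CommutativeRing.1# S))
  (1-ζʲ-regular : ∀ j → 0 < j → j < ord σ →
                  InRing.NonZeroDivisor S (CommutativeRing._-_ S (CommutativeRing.1# S) (InRing.pow S ζ j))) where

  open import Level using (0ℓ)
  open import Data.Nat using () renaming (_*_ to _*ℕ_)
  import Data.Nat.Properties as ℕP
  open import Data.Bool using (false; if_then_else_; not; _∨_; T)
  open import Data.Bool.Properties using (T?)
  open import Data.List as List using (List)
  open import Data.List.Relation.Unary.All as All using ()
  open import Data.List.Relation.Unary.All.Properties using (all⁺; all⁻; ¬All⇒Any¬)
  open import Data.List.Relation.Unary.Any using (satisfied)
  open import Data.Vec using (Vec; []; _∷_; toList)
  open import Data.Product using (_,_; uncurry)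
  open import Function using (_∘_)
  open import Data.Unit using (tt)
  open import Relation.Nullary using (¬_; contradiction; yes; no)
  import Relation.Binary.PropositionalEquality as ≡
  open import Algebra.Bundles using (AbelianGroup)
  import Algebra.Properties.Group as GroupProperties
  import Algebra.Properties.Ring as RingProperties
  import Algebra.Properties.CommutativeSemigroup as CommutativeSemigroupProperties
  import Data.Vec.Properties as VecP
  open Admissible adm renaming (isCommutativeRing to 𝔑-isCommutativeRing)
  open CommutativeRing S
  open InRing S
  open BigOperators S
  open Enumeration using (triples-isEnumeration; allVecs-isEnumeration; isEnumeration⇒∈)
  open import Relation.Binary.Reasoning.Setoid setoid
  instance _ = ord-nonZero

  private
    𝔑 : CommutativeRing 0ℓ 0ℓ
    𝔑 = record { isCommutativeRing = 𝔑-isCommutativeRing }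
    module 𝔑 = CommutativeRing 𝔑
    variable n : ℕ
  open CommutativeSemigroupProperties 𝔑.+-commutativeSemigroup using () renaming (interchange to 𝔑-+-interchange)

  χ′ : El σ → Carrier
  χ′ = χ σ ζ

  χ-+ : ∀ a b → χ′ (addR σ a b) ≈ χ′ a * χ′ b
  χ-+ a b = begin
    pow ζ (chiExp σ (addR σ a b))                ≈⟨ ≡⇒≈ (≡.cong (pow ζ) (chiExp-+ a b)) ⟩
    pow ζ ((chiExp σ a ℕ.+ chiExp σ b) % ord σ)  ≈⟨ pow-root-% (ord σ) ζᴺ≈1 _ ⟩
    pow ζ (chiExp σ a ℕ.+ chiExp σ b)            ≈⟨ pow-+ ζ (chiExp σ a) (chiExp σ b) ⟩
    χ′ a * χ′ b                                  ∎

  χ-0 : χ′ (zeroR σ) ≈ 1#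
  χ-0 = ≡⇒≈ (≡.cong (pow ζ) chiExp-0)

  members : Code σ n → List (Word σ n)
  members {n} C = List.filterᵇ C (allWords σ n)

  words-isEnumeration : ∀ n → Enumeration.IsEnumeration (VecP.≡-dec (_≟ᴿ_ σ)) (allWords σ n)
  words-isEnumeration = allVecs-isEnumeration (_≟ᴿ_ σ) elems-isEnumeration

  _⊞_ : Word σ n → Word σ n → Word σ n
  _⊞_ = Vec.zipWith (addR σ)

  ⊟_ : Word σ n → Word σ n
  ⊟_ = Vec.map (negR σ)

  words-abelianGroup : ℕ → AbelianGroup 0ℓ 0ℓ
  words-abelianGroup n = record { isAbelianGroup = VecLemmas.zipWith-isAbelianGroup {k = n} 𝔑.+-isAbelianGroup }

  dot-⊞ˡ : ∀ (u u′ b : Word σ n) → dot σ (u ⊞ u′) b ≡ addR σ (dot σ u b) (dot σ u′ b)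
  dot-⊞ˡ []      []        []      = ≡.sym (𝔑.+-identityʳ (zeroR σ))
  dot-⊞ˡ (x ∷ u) (x′ ∷ u′) (y ∷ b) =
    ≡.trans (≡.cong₂ (addR σ) (𝔑.distribʳ y x x′) (dot-⊞ˡ u u′ b)) (𝔑-+-interchange _ _ _ _)

  isZero⇒≡0 : ∀ a → T (isZero σ a) → a ≡ zeroR σ
  isZero⇒≡0 a _ with _≟ᴿ_ σ a (zeroR σ)
  ... | yes a≡0 = a≡0

  ≡0⇒isZero : ∀ {a} → a ≡ zeroR σ → T (isZero σ a)
  ≡0⇒isZero {a} a≡0 with _≟ᴿ_ σ a (zeroR σ)
  ... | yes _  = tt
  ... | no a≢0 = a≢0 a≡0

  dual⇒dot≡0 : ∀ (C : Code σ n) {b u} → T (dual σ C b) → C u ≡ true → dot σ u b ≡ zeroR σ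
  dual⇒dot≡0 {n} C {b} {u} b∈C⊥ u∈C = isZero⇒≡0 (dot σ u b) (≡.subst (λ c → T (not c ∨ isZero σ (dot σ u b))) u∈C
    (All.lookup (all⁺ _ (allWords σ n) b∈C⊥) (isEnumeration⇒∈ _ (words-isEnumeration n) u)))

  ¬dual⇒witness : ∀ (C : Code σ n) {b} → ¬ T (dual σ C b) → ∃ λ u → C u ≡ true × dot σ u b ≢ zeroR σ
  ¬dual⇒witness {n} C {b} b∉C⊥ with satisfied (¬All⇒Any¬ (λ u → T? _) (allWords σ n) (b∉C⊥ ∘ all⁻ _))
  ... | u , ¬T with C u in u∈C
  ...   | true  = u , u∈C , λ dot≡0 → ¬T (≡0⇒isZero dot≡0)
  ...   | false = contradiction tt ¬T

  C-⊞-invariant : ∀ {C : Code σ n} → IsLinear σ C → ∀ {u′} → C u′ ≡ true → ∀ u → C (u ⊞ u′) ≡ C u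
  C-⊞-invariant {C = C} lin {u′} u′∈C u with C u in u∈C
  ... | true  = linear-+ lin u∈C u′∈C
  ... | false with C (u ⊞ u′) in u+u′∈C
  ...   | false = ≡.refl
  ...   | true  = contradiction (≡.trans (≡.sym u∈C) (≡.trans (≡.cong C (≡.sym (//-rightDividesʳ u′ u)))
                                                   (linear-+ lin u+u′∈C (linear-neg lin u′∈C)))) λ ()
    where open GroupProperties (AbelianGroup.group (words-abelianGroup _))

  Σ-members-translate : ∀ {C : Code σ n} → IsLinear σ C → ∀ {u′} → C u′ ≡ true → ∀ f →
                        Σ (members C) (λ u → f (u ⊞ u′)) ≈ Σ (members C) f
  Σ-members-translate {n} {C} lin {u′} u′∈C f = begin
    Σ (members C) (λ u → f (u ⊞ u′))                       ≈⟨ Σ-filterᵇ C (allWords σ n) _ ⟩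
    Σ (allWords σ n) (λ u → if C u then f (u ⊞ u′) else 0#) ≈⟨ Σ-cong (allWords σ n) (λ u → ≡⇒≈ (≡.cong (λ c → if c then _ else 0#) (≡.sym (C-⊞-invariant lin u′∈C u)))) ⟩
    Σ (allWords σ n) (g ∘ (_⊞ u′))                         ≈⟨ Σ-reindex (VecP.≡-dec (_≟ᴿ_ σ)) {allWords σ n} (words-isEnumeration n) (_⊞ u′) (_⊞ (⊟ u′)) (//-rightDividesʳ u′) (//-rightDividesˡ u′) g ⟩
    Σ (allWords σ n) g                                     ≈⟨ Σ-filterᵇ C (allWords σ n) f ⟨
    Σ (members C) f                                        ∎
    where
    open GroupProperties (AbelianGroup.group (words-abelianGroup n)) using (//-rightDividesʳ; //-rightDividesˡ)
    g : Word σ n → Carrier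
    g u = if C u then f u else 0#

  Σ-χ-dot-dual : ∀ (C : Code σ n) {b} → T (dual σ C b) → Σ (members C) (λ u → χ′ (dot σ u b)) ≈ size σ C ·ₙ 1#
  Σ-χ-dot-dual {n} C {b} b∈C⊥ = begin
    Σ (members C) (λ u → χ′ (dot σ u b))   ≈⟨ Σ-filterᵇ-cong C (allWords σ n) (λ u u∈C → trans (≡⇒≈ (≡.cong χ′ (dual⇒dot≡0 C b∈C⊥ u∈C))) χ-0) ⟩
    Σ (members C) (λ _ → 1#)               ≈⟨ Σ-1# (members C) ⟩
    size σ C ·ₙ 1#                         ∎

  -- A character value χ(u′·b) ≠ 1 fixes the sum, which is then killed by the regular element 1 - χ(u′·b).
  Σ-χ-dot-¬dual : ∀ {C : Code σ n} → IsLinear σ C → ∀ {b} → ¬ T (dual σ C b) → Σ (members C) (λ u → χ′ (dot σ u b)) ≈ 0#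
  Σ-χ-dot-¬dual {n} {C} lin {b} b∉C⊥ with ¬dual⇒witness C b∉C⊥
  ... | u , u∈C , u·b≢0 with χ-nontrivial lin u∈C u·b≢0
  ...   | u′ , u′∈C , j≢0 =
    1-ζʲ-regular j (ℕP.n≢0⇒n>0 j≢0) (chiExp-< _) sum (begin
      (1# - pow ζ j) * sum         ≈⟨ RingProperties.[y-z]x≈yx-zx ring sum 1# (pow ζ j) ⟩
      1# * sum - pow ζ j * sum     ≈⟨ +-cong (*-identityˡ sum) (-‿cong invariant) ⟩
      sum - sum                    ≈⟨ -‿inverseʳ sum ⟩
      0#                           ∎)
    where
    j : ℕ
    j = chiExp σ (dot σ u′ b)
    sum : Carrier
    sum = Σ (members C) (λ u → χ′ (dot σ u b))
    invariant : pow ζ j * sum ≈ sum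
    invariant = begin
      χ′ (dot σ u′ b) * sum                                  ≈⟨ *-distribˡ-Σ (members C) _ _ ⟩
      Σ (members C) (λ u → χ′ (dot σ u′ b) * χ′ (dot σ u b)) ≈⟨ Σ-cong (members C) (λ u → trans (*-comm _ _) (sym (χ-+ _ _))) ⟩
      Σ (members C) (λ u → χ′ (addR σ (dot σ u b) (dot σ u′ b))) ≈⟨ Σ-cong (members C) (λ u → ≡⇒≈ (≡.cong χ′ (≡.sym (dot-⊞ˡ u u′ b)))) ⟩
      Σ (members C) (λ u → χ′ (dot σ (u ⊞ u′) b))            ≈⟨ Σ-members-translate lin u′∈C (λ u → χ′ (dot σ u b)) ⟩
      sum                                                    ∎

  Σ-χ-dot : ∀ {C : Code σ n} → IsLinear σ C → ∀ b →
            Σ (members C) (λ u → χ′ (dot σ u b)) ≈ (if dual σ C b then size σ C ·ₙ 1# else 0#)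
  Σ-χ-dot {C = C} lin b with dual σ C b in b∈C⊥
  ... | true  = Σ-χ-dot-dual C (≡.subst T (≡.sym b∈C⊥) tt)
  ... | false = Σ-χ-dot-¬dual lin (≡.subst T b∈C⊥)

  -- Multiplying by |C|, the indicator of C^⊥ becomes a character sum over C.
  ·ₙ-Σ-dual : ∀ {C : Code σ n} → IsLinear σ C → ∀ f →
              size σ C ·ₙ Σ (members (dual σ C)) f ≈ Σ (allWords σ n) (λ b → Σ (members C) (λ u → χ′ (dot σ u b)) * f b)
  ·ₙ-Σ-dual {n} {C} lin f = begin
    size σ C ·ₙ Σ (members (dual σ C)) f                                     ≈⟨ ·ₙ-cong (size σ C) (Σ-filterᵇ (dual σ C) (allWords σ n) f) ⟩
    size σ C ·ₙ Σ (allWords σ n) (λ b → if dual σ C b then f b else 0#)     ≈⟨ ·ₙ-distrib-Σ (size σ C) (allWords σ n) _ ⟩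
    Σ (allWords σ n) (λ b → size σ C ·ₙ (if dual σ C b then f b else 0#))   ≈⟨ Σ-cong (allWords σ n) indicator ⟩
    Σ (allWords σ n) (λ b → Σ (members C) (λ u → χ′ (dot σ u b)) * f b)     ∎
    where
    indicator : ∀ b → size σ C ·ₙ (if dual σ C b then f b else 0#) ≈ Σ (members C) (λ u → χ′ (dot σ u b)) * f b
    indicator b with dual σ C b | Σ-χ-dot lin b
    ... | true  | Σ≈ = trans (sym (·ₙ-1#-* (size σ C) (f b))) (*-congʳ (sym Σ≈))
    ... | false | Σ≈ = trans (·ₙ-0# (size σ C)) (sym (trans (*-congʳ Σ≈) (zeroˡ (f b))))

  positions : Word σ n → Word σ n → Word σ n → Vec (Triple σ) n
  positions u v w = Vec.zipWith _,_ u (Vec.zipWith _,_ v w)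

  monomial : (Triple σ → Carrier) → Word σ n → Word σ n → Word σ n → Carrier
  monomial x u v w = Π (toList (positions u v w)) x

  Jac-monomials : ∀ x (C D : Code σ n) w → Jac σ ζ C D w x ≈ Σ (members C) (λ u → Σ (members D) (λ v → monomial x u v w))
  Jac-monomials x C D w = Σ-cong (members C) λ u → Σ-cong (members D) λ v →
    Π-pow-count (_≟³_ σ) {allTriples σ} (triples-isEnumeration (_≟ᴿ_ σ) {elems σ} elems-isEnumeration) x (toList (positions u v w))

  monomial-subst₁ : ∀ x (u v w : Word σ n) →
    Π (toList (positions u v w)) (subst₁ σ ζ x) ≈ Σ (allWords σ n) (λ b → χ′ (dot σ u b) * monomial x b v w)
  monomial-subst₁ {n} x u v w = trans (Π-Σ-expand (elems σ) F (positions u v w)) (Σ-cong (allWords σ n) (factor u v w))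
    where
    F : Triple σ → El σ → Carrier
    F (a₁ , a₂ , a₃) b = χ′ (mulR σ a₁ b) * x (b , a₂ , a₃)
    factor : ∀ {n} (u v w b : Word σ n) →
             Π (toList (Vec.zip (positions u v w) b)) (uncurry F) ≈ χ′ (dot σ u b) * monomial x b v w
    factor []      []      []      []      = sym (trans (*-congʳ χ-0) (*-identityˡ 1#))
    factor (u₀ ∷ u) (v₀ ∷ v) (w₀ ∷ w) (b₀ ∷ b) = begin
      (χ′ (mulR σ u₀ b₀) * x (b₀ , v₀ , w₀)) * Π (toList (Vec.zip (positions u v w) b)) (uncurry F)
        ≈⟨ *-congˡ (factor u v w b) ⟩
      (χ′ (mulR σ u₀ b₀) * x (b₀ , v₀ , w₀)) * (χ′ (dot σ u b) * monomial x b v w)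
        ≈⟨ *-interchange _ _ _ _ ⟩
      (χ′ (mulR σ u₀ b₀) * χ′ (dot σ u b)) * (x (b₀ , v₀ , w₀) * monomial x b v w)
        ≈⟨ *-congʳ (χ-+ _ _) ⟨
      χ′ (dot σ (u₀ ∷ u) (b₀ ∷ b)) * monomial x (b₀ ∷ b) (v₀ ∷ v) (w₀ ∷ w) ∎

  monomial-subst₂ : ∀ x (u v w : Word σ n) →
    Π (toList (positions u v w)) (subst₂ σ ζ x) ≈
    Σ (allWords σ n) (λ b₁ → Σ (allWords σ n) (λ b₂ → (χ′ (dot σ u b₁) * χ′ (dot σ v b₂)) * monomial x b₁ b₂ w))
  monomial-subst₂ {n} x u v w = begin
    Π (toList (positions u v w)) (subst₂ σ ζ x)
      ≈⟨ Π-Σ-expand (elems σ) (λ a b₁ → Σ (elems σ) (F (a , b₁))) (positions u v w) ⟩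
    Σ (allWords σ n) (λ b₁ → Π (toList (Vec.zip (positions u v w) b₁)) (λ ab₁ → Σ (elems σ) (F ab₁)))
      ≈⟨ Σ-cong (allWords σ n) (λ b₁ → Π-Σ-expand (elems σ) F (Vec.zip (positions u v w) b₁)) ⟩
    Σ (allWords σ n) (λ b₁ → Σ (allWords σ n) (λ b₂ → Π (toList (Vec.zip (Vec.zip (positions u v w) b₁) b₂)) (uncurry F)))
      ≈⟨ Σ-cong (allWords σ n) (λ b₁ → Σ-cong (allWords σ n) (factor u v w b₁)) ⟩
    Σ (allWords σ n) (λ b₁ → Σ (allWords σ n) (λ b₂ → (χ′ (dot σ u b₁) * χ′ (dot σ v b₂)) * monomial x b₁ b₂ w)) ∎
    where
    F : Triple σ × El σ → El σ → Carrier
    F ((a₁ , a₂ , a₃) , b₁) b₂ = χ′ (addR σ (mulR σ a₁ b₁) (mulR σ a₂ b₂)) * x (b₁ , b₂ , a₃)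
    factor : ∀ {n} (u v w b₁ b₂ : Word σ n) →
             Π (toList (Vec.zip (Vec.zip (positions u v w) b₁) b₂)) (uncurry F) ≈ (χ′ (dot σ u b₁) * χ′ (dot σ v b₂)) * monomial x b₁ b₂ w
    factor []       []       []       []        []        = sym (trans (*-congʳ (trans (*-cong χ-0 χ-0) (*-identityˡ 1#))) (*-identityˡ 1#))
    factor (u₀ ∷ u) (v₀ ∷ v) (w₀ ∷ w) (b₁₀ ∷ b₁) (b₂₀ ∷ b₂) = begin
      (χ′ (addR σ (mulR σ u₀ b₁₀) (mulR σ v₀ b₂₀)) * x (b₁₀ , b₂₀ , w₀)) * Π (toList (Vec.zip (Vec.zip (positions u v w) b₁) b₂)) (uncurry F)
        ≈⟨ *-cong (*-congʳ (χ-+ _ _)) (factor u v w b₁ b₂) ⟩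
      ((χ′ (mulR σ u₀ b₁₀) * χ′ (mulR σ v₀ b₂₀)) * x (b₁₀ , b₂₀ , w₀)) * ((χ′ (dot σ u b₁) * χ′ (dot σ v b₂)) * monomial x b₁ b₂ w)
        ≈⟨ *-interchange _ _ _ _ ⟩
      ((χ′ (mulR σ u₀ b₁₀) * χ′ (mulR σ v₀ b₂₀)) * (χ′ (dot σ u b₁) * χ′ (dot σ v b₂))) * (x (b₁₀ , b₂₀ , w₀) * monomial x b₁ b₂ w)
        ≈⟨ *-congʳ (trans (*-interchange _ _ _ _) (sym (*-cong (χ-+ _ _) (χ-+ _ _)))) ⟩
      (χ′ (dot σ (u₀ ∷ u) (b₁₀ ∷ b₁)) * χ′ (dot σ (v₀ ∷ v) (b₂₀ ∷ b₂))) * monomial x (b₁₀ ∷ b₁) (b₂₀ ∷ b₂) (w₀ ∷ w) ∎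

  module _ (x : Triple σ → Carrier) (w : Word σ n) where

    χ-sum : Code σ n → Word σ n → Carrier
    χ-sum C b = Σ (members C) (λ u → χ′ (dot σ u b))

    jacobi-dual₁ : ∀ {C : Code σ n} (D : Code σ n) → IsLinear σ C →
                   size σ C ·ₙ Jac σ ζ (dual σ C) D w x ≈ Jac σ ζ C D w (subst₁ σ ζ x)
    jacobi-dual₁ {C} D linC = begin
      size σ C ·ₙ Jac σ ζ (dual σ C) D w x
        ≈⟨ ·ₙ-cong (size σ C) (Jac-monomials x (dual σ C) D w) ⟩
      size σ C ·ₙ Σ (members (dual σ C)) (λ b → Σ (members D) (λ v → monomial x b v w))
        ≈⟨ ·ₙ-Σ-dual linC _ ⟩
      Σ W (λ b → χ-sum C b * Σ (members D) (λ v → monomial x b v w))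
        ≈⟨ Σ-*-comm W (members C) _ _ ⟩
      Σ (members C) (λ u → Σ W (λ b → χ′ (dot σ u b) * Σ (members D) (λ v → monomial x b v w)))
        ≈⟨ Σ-cong (members C) (λ u → Σ-cong W (λ b → *-distribˡ-Σ (members D) _ _)) ⟩
      Σ (members C) (λ u → Σ W (λ b → Σ (members D) (λ v → χ′ (dot σ u b) * monomial x b v w)))
        ≈⟨ Σ-cong (members C) (λ u → Σ-comm W (members D) _) ⟩
      Σ (members C) (λ u → Σ (members D) (λ v → Σ W (λ b → χ′ (dot σ u b) * monomial x b v w)))
        ≈⟨ Σ-cong (members C) (λ u → Σ-cong (members D) (λ v → monomial-subst₁ x u v w)) ⟨
      Σ (members C) (λ u → Σ (members D) (λ v → monomial (subst₁ σ ζ x) u v w))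
        ≈⟨ Jac-monomials (subst₁ σ ζ x) C D w ⟨
      Jac σ ζ C D w (subst₁ σ ζ x) ∎
      where
      W : List (Word σ n)
      W = allWords σ n

    jacobi-dual₂ : ∀ {C D : Code σ n} → IsLinear σ C → IsLinear σ D →
                   (size σ C *ℕ size σ D) ·ₙ Jac σ ζ (dual σ C) (dual σ D) w x ≈ Jac σ ζ C D w (subst₂ σ ζ x)
    jacobi-dual₂ {C} {D} linC linD = begin
      (size σ C *ℕ size σ D) ·ₙ Jac σ ζ (dual σ C) (dual σ D) w x
        ≈⟨ ·ₙ-·ₙ (size σ C) (size σ D) _ ⟩
      size σ C ·ₙ (size σ D ·ₙ Jac σ ζ (dual σ C) (dual σ D) w x)
        ≈⟨ ·ₙ-cong (size σ C) (trans (·ₙ-cong (size σ D) (Jac-monomials x (dual σ C) (dual σ D) w)) (·ₙ-distrib-Σ (size σ D) (members (dual σ C)) _)) ⟩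
      size σ C ·ₙ Σ (members (dual σ C)) (λ b₁ → size σ D ·ₙ Σ (members (dual σ D)) (λ b₂ → monomial x b₁ b₂ w))
        ≈⟨ ·ₙ-cong (size σ C) (Σ-cong (members (dual σ C)) (λ b₁ → ·ₙ-Σ-dual linD _)) ⟩
      size σ C ·ₙ Σ (members (dual σ C)) (λ b₁ → Σ W (λ b₂ → χ-sum D b₂ * monomial x b₁ b₂ w))
        ≈⟨ ·ₙ-Σ-dual linC _ ⟩
      Σ W (λ b₁ → χ-sum C b₁ * Σ W (λ b₂ → χ-sum D b₂ * monomial x b₁ b₂ w))
        ≈⟨ Σ-cong W (λ b₁ → trans (*-distribˡ-Σ W _ _) (Σ-cong W λ b₂ → sym (*-assoc _ _ _))) ⟩
      Σ W (λ b₁ → Σ W (λ b₂ → (χ-sum C b₁ * χ-sum D b₂) * monomial x b₁ b₂ w))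
        ≈⟨ Σ-cong W (λ b₁ → Σ-cong W (λ b₂ → Σ-*-Σ-* (members C) (members D) _ _ _)) ⟩
      Σ W (λ b₁ → Σ W (λ b₂ → Σ (members C) (λ u → Σ (members D) (λ v → (χ′ (dot σ u b₁) * χ′ (dot σ v b₂)) * monomial x b₁ b₂ w))))
        ≈⟨ Σ²-comm W W (members C) (members D) _ ⟩
      Σ (members C) (λ u → Σ (members D) (λ v → Σ W (λ b₁ → Σ W (λ b₂ → (χ′ (dot σ u b₁) * χ′ (dot σ v b₂)) * monomial x b₁ b₂ w))))
        ≈⟨ Σ-cong (members C) (λ u → Σ-cong (members D) (λ v → monomial-subst₂ x u v w)) ⟨
      Σ (members C) (λ u → Σ (members D) (λ v → monomial (subst₂ σ ζ x) u v w))
        ≈⟨ Jac-monomials (subst₂ σ ζ x) C D w ⟨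
      Jac σ ζ C D w (subst₂ σ ζ x) ∎
      where
      W : List (Word σ n)
      W = allWords σ n

module Instances where

  open import Data.Nat as ℕ using (ℕ; NonZero; suc; _≤_; s≤s; z≤n)
  import Data.Nat.Properties as ℕP
  open import Data.Nat.Primality using (Prime; prime⇒nonZero)
  open import Data.Fin using (Fin; toℕ)
  import Data.Fin.Properties as FinP
  open import Data.List using (allFin)
  open import Data.Vec as Vec using (Vec; []; _∷_; head)
  import Data.Vec.Properties as VecP
  open import Data.Bool using (true)
  open import Data.Product using (_,_; _×_; ∃; proj₁; proj₂)
  open import Algebra.Bundles using (CommutativeRing)
  import Algebra.Properties.Ring as RingProperties
  open import Relation.Binary.PropositionalEquality
  open import Defs
  open Enumeration using (allFin-isEnumeration; allVecs-isEnumeration)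

  admissible-ℤ/ : ∀ k .{{_ : NonZero k}} (2≤k : 2 ≤ k) → Admissible (Zk k 2≤k)
  admissible-ℤ/ k 2≤k = record
    { elems-isEnumeration = allFin-isEnumeration k
    ; oneR                = Mod.1ₘ k
    ; isCommutativeRing   = CommutativeRing.isCommutativeRing commutativeRing
    ; ord-nonZero         = ℕ.>-nonZero (ℕP.≤-trans (s≤s z≤n) 2≤k)
    ; chiExp-+            = λ a b → toℕ-reduce _
    ; chiExp-0            = toℕ-0ₘ
    ; chiExp-<            = FinP.toℕ<n
    ; linear-+            = λ lin → proj₁ (proj₂ lin) _ _
    ; linear-neg          = λ lin → proj₂ (proj₂ lin) _
    ; χ-nontrivial        = λ {_} {_} _ {u} u∈C u·b≢0 →
                              u , u∈C , λ toℕ≡0 → u·b≢0 (FinP.toℕ-injective (trans toℕ≡0 (sym toℕ-0ₘ)))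
    }
    where open ModularArithmetic k

  admissible-𝔽 : ∀ p m .{{_ : NonZero p}} (p-prime : Prime p) (F : Vec (Fin p) (suc m)) irreducible λ-primitive →
                 Admissible (Fq p m p-prime F irreducible λ-primitive)
  admissible-𝔽 p m p-prime F irreducible λ-primitive = record
    { elems-isEnumeration = allVecs-isEnumeration FinP._≟_ {allFin p} (allFin-isEnumeration p) (suc m)
    ; oneR                = FieldRep.oneF p m F
    ; isCommutativeRing   = isCommutativeRing
    ; ord-nonZero         = prime⇒nonZero p-prime
    ; chiExp-+            = λ { (x ∷ a) (y ∷ b) → toℕ-reduce _ }
    ; chiExp-0            = toℕ-0ₘ
    ; chiExp-<            = λ a → FinP.toℕ<n (head a)
    ; linear-+            = λ lin → proj₁ (proj₂ lin) _ _
    ; linear-neg          = linear-neg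
    ; χ-nontrivial        = χ-nontrivial
    }
    where
    σ = Fq p m p-prime F irreducible λ-primitive
    open ModularArithmetic p using (toℕ-reduce; toℕ-0ₘ)
    open PolynomialQuotient p m F using (commutativeRing)
    open CommutativeRing commutativeRing using (ring; isCommutativeRing; _+_; _*_; -_; 1#; *-assoc; zeroʳ; distribˡ)
    open ConstantTermPairing p m p-prime F λ-primitive using (head-mulF-nondegenerate)

    linear-neg : ∀ {n} {C : Code σ n} → IsLinear σ C → ∀ {u} → C u ≡ true → C (Vec.map -_ u) ≡ true
    linear-neg {C = C} lin {u} u∈C =
      subst (λ v → C v ≡ true) (VecP.map-cong (RingProperties.-1*x≈-x ring) u) (proj₂ (proj₂ lin) (- 1#) u u∈C)

    dot-·ˡ : ∀ {n} c (u b : Word σ n) → dot σ (Vec.map (c *_) u) b ≡ c * dot σ u b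
    dot-·ˡ c []      []      = sym (zeroʳ c)
    dot-·ˡ c (x ∷ u) (y ∷ b) = trans (cong₂ _+_ (*-assoc c x y) (dot-·ˡ c u b)) (sym (distribˡ c _ _))

    χ-nontrivial : ∀ {n} {C : Code σ n} → IsLinear σ C → ∀ {u b} → C u ≡ true → dot σ u b ≢ zeroR σ →
                   ∃ λ u′ → C u′ ≡ true × toℕ (head (dot σ u′ b)) ≢ 0
    χ-nontrivial lin {u} {b} u∈C u·b≢0 with head-mulF-nondegenerate (dot σ u b) u·b≢0
    ... | c , head≢0 = Vec.map (c *_) u , proj₂ (proj₂ lin) c u u∈C , λ toℕ≡0 →
      head≢0 (trans (cong head (sym (dot-·ˡ c u b))) (FinP.toℕ-injective (trans toℕ≡0 (sym toℕ-0ₘ))))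

  admissible : (σ : Spec) → Admissible σ
  admissible (Fq p m p-prime F irreducible λ-primitive) = admissible-𝔽 p m p-prime F irreducible λ-primitive
  admissible (Zk k 2≤k)                             = admissible-ℤ/ k 2≤k

open import Level using (Level)
open import Data.Nat using (_*_)
open import Data.Product using (_,_)
open Instances using (admissible)

corollary3p4 : ∀ {c ℓ : Level} (S : CommutativeRing c ℓ) (σ : Spec)
    (ζ : CommutativeRing.Carrier S) →
    CommutativeRing._≈_ S (InRing.pow S ζ (ord σ)) (CommutativeRing.1# S) →
    (∀ j → 0 < j → j < ord σ →
      InRing.NonZeroDivisor S (CommutativeRing._-_ S (CommutativeRing.1# S) (InRing.pow S ζ j))) →
    (n : ℕ) (C D : Code σ n) → IsLinear σ C → IsLinear σ D → (w : Word σ n) →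
    (x : Triple σ → CommutativeRing.Carrier S) →
    CommutativeRing._≈_ S
      (InRing._·ₙ_ S (size σ C) (InRing.Jac S σ ζ (dual σ C) D w x))
      (InRing.Jac S σ ζ C D w (InRing.subst₁ S σ ζ x))
    ×
    CommutativeRing._≈_ S
      (InRing._·ₙ_ S (size σ C * size σ D) (InRing.Jac S σ ζ (dual σ C) (dual σ D) w x))
      (InRing.Jac S σ ζ C D w (InRing.subst₂ S σ ζ x))
corollary3p4 S σ ζ ζᴺ≈1 1-ζʲ-regular n C D linC linD w x = jacobi-dual₁ x w D linC , jacobi-dual₂ x w linC linD
  where open CharacterSums S (admissible σ) ζ ζᴺ≈1 1-ζʲ-regular
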